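{- Let $k\ge 1$ be an integer and let $\Pi^{(k)}$ be the set of $(k+1)$-nonnesting open partition diagrams. To each $\pi\in\Pi^{(k)}$ associate the label $\ell(\pi)=[s_0,\dots,s_{k-1}]$, where $s_i$ is the number of semi-arcs of $\pi$ with nesting index $\ge i$. Consider the generating tree with root label $[0,0,\dots,0]$ and succession rule sending $[s_0,s_1,\dots,s_{k-1}]$ to the following labels: (1) $[s_0,s_1,\dots,s_{k-1}]$; (2) $[s_0+1,s_1,\dots,s_{k-1}]$; (3) $[s_0,s_1-1,\dots,s_{j-1}-1,i,s_{j+1},\dots,s_{k-1}]$ for each $1\le j\le k-1$ and each $i$ with $s_j\le i\le s_{j-1}-1$; (4) $[s_0-1,s_1-1,\dots,s_{j-1}-1,i,s_{j+1},\dots,s_{k-1}]$ for each $1\le j\le k-1$ and each $i$ with $s_j\le i\le s_{j-1}-1$; (5) $[s_0,s_1-1,\dots,s_{k-1}-1]$ and $[s_0-1,s_1-1,\dots,s_{k-1}-1]$, if $s_{k-1}>0$. Then for every $n\ge 0$ the number of diagrams in $\Pi^{(k)}$ of size $n$ equals the number of nodes at level $n$ of this generating tree.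
   Context: An open partition diagram of size $n\ge 0$ consists of vertices $1,\dots,n$ in a row, a set of arcs $(a,b)$ with $1\le a<b\le n$ and a set of semi-arcs $(a,*)$ with $1\le a\le n$ (a semi-arc has a left end-point but no right end-point), such that every vertex is the left end-point of at most one arc or semi-arc and the right end-point of at most one arc. (Equivalently: a set partition of $\{1,\dots,n\}$ with each block marked closed or open; block $\{a_1<\dots<a_r\}$ gives arcs $(a_1,a_2),\dots,(a_{r-1},a_r)$ and, if open, the semi-arc $(a_r,*)$.) A $k$-nesting is a set of $k$ arcs $(i_1,j_1),\dots,(i_k,j_k)$ with $i_1<\dots<i_k<j_k<\dots<j_1$. A future $k$-nesting is a $(k-1)$-nesting $(i_2,j_2),\dots,(i_k,j_k)$ together with a semi-arc $(i_1,*)$ with $i_1<i_2$. An open partition diagram is $k$-nonnesting if it contains neither a $k$-nesting nor a future $k$-nesting. The nesting index of a semi-arc $(a,*)$ is the largest $j\ge0$ such that there is a $j$-nesting all of whose arcs have left end-points greater than $a$ (equivalently, the largest $j$ such that the semi-arc is in a future $(j+1)$-nesting). A generating tree with root label $L_0$ and a succession rule (assigning to each label a finite list of labels, with multiplicity) is the rooted tree whose root, at level $0$, has label $L_0$, and in which each node with label $L$ has one child for each entry of the list assigned to $L$, labelled by that entry; level $n$ consists of the nodes at distance $n$ from the root. -}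

module Defs where

open import Data.Nat using (ℕ; zero; suc; _+_; _∸_; _<ᵇ_; _≡ᵇ_)
open import Data.Fin using (Fin; toℕ) renaming (_<_ to _<ᶠ_)
open import Data.Vec using (Vec; lookup; tabulate; replicate)
open import Data.List using (List; []; _∷_; _++_; map; concatMap; upTo; length; filter)
open import Data.List.Base using (allFin)
open import Data.Bool using (Bool; true; false; if_then_else_)
open import Data.Product using (Σ; _×_)
open import Data.Empty using (⊥)
open import Relation.Nullary using (¬_)
open import Relation.Binary.PropositionalEquality using (_≡_)

-- Vertices are Fin n (vertex a stands for a+1).  For each vertex a,
-- `out a` records what a is the LEFT end-point of:
--   none   : nothing,
--   semi   : the semi-arc (a,*),
--   arc b  : the arc (a,b).
-- This encodes "each vertex is the left end-point of at most one arc or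
-- semi-arc"; the validity conditions require a < b for arcs and that every
-- vertex is the right end-point of at most one arc.

data Out (n : ℕ) : Set where
  none : Out n
  semi : Out n
  arc  : Fin n → Out n

IsArc : {n : ℕ} → Vec (Out n) n → Fin n → Fin n → Set
IsArc out a b = lookup out a ≡ arc b

IsSemiArc : {n : ℕ} → Vec (Out n) n → Fin n → Set
IsSemiArc out a = lookup out a ≡ semi

record OpenPartitionDiagram (n : ℕ) : Set where
  constructor mkOPD
  field
    out : Vec (Out n) n
    .arcs-increasing : ∀ a b → IsArc out a b → a <ᶠ b
    .right-unique    : ∀ a a′ b → IsArc out a b → IsArc out a′ b → a ≡ a′
open OpenPartitionDiagram public

record Nesting {n : ℕ} (d : OpenPartitionDiagram n) (m : ℕ) : Set where
  field
    lefts  : Fin m → Fin n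
    rights : Fin m → Fin n
    isArc  : ∀ t → IsArc (out d) (lefts t) (rights t)
    lefts-increasing  : ∀ t u → t <ᶠ u → lefts t <ᶠ lefts u
    rights-decreasing : ∀ t u → t <ᶠ u → rights u <ᶠ rights t
    inner : ∀ t → lefts t <ᶠ rights t
open Nesting public

FutureNesting : {n : ℕ} → OpenPartitionDiagram n → ℕ → Set
FutureNesting d zero    = ⊥
FutureNesting {n} d (suc m) =
  Σ (Fin n) λ a → IsSemiArc (out d) a ×
    Σ (Nesting d m) λ N → ∀ t → a <ᶠ lefts N t

record NonnestingDiagram (k n : ℕ) : Set where
  constructor mkΠ
  field
    diagram : OpenPartitionDiagram n
    .no-nesting        : ¬ Nesting diagram (suc k)
    .no-future-nesting : ¬ FutureNesting diagram (suc k)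
open NonnestingDiagram public

-- s_m, indexing by a natural number (0 if out of range; never used so).
_at_ : {k : ℕ} → Vec ℕ k → ℕ → ℕ
Vec.[] at m = 0
(x Vec.∷ xs) at zero = x
(x Vec.∷ xs) at suc m = xs at m

range : ℕ → ℕ → List ℕ
range a b = map (a +_) (upTo (b ∸ a))

modLabel : {k : ℕ} → Vec ℕ k → ℕ → ℕ → ℕ → Vec ℕ k
modLabel s δ j i = tabulate λ m →
  if toℕ m ≡ᵇ 0 then (s at 0) ∸ δ
  else if toℕ m <ᵇ j then (s at toℕ m) ∸ 1
  else if toℕ m ≡ᵇ j then i
  else s at toℕ m

lastLabel : {k : ℕ} → Vec ℕ k → ℕ → Vec ℕ k
lastLabel s δ = tabulate λ m →
  if toℕ m ≡ᵇ 0 then (s at 0) ∸ δ else (s at toℕ m) ∸ 1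

inc0 : {k : ℕ} → Vec ℕ k → Vec ℕ k
inc0 s = tabulate λ m → if toℕ m ≡ᵇ 0 then suc (s at 0) else s at toℕ m

js : ℕ → List ℕ
js k = range 1 k

rule34 : {k : ℕ} → Vec ℕ k → ℕ → List (Vec ℕ k)
rule34 {k} s δ =
  concatMap (λ j → map (modLabel s δ j) (range (s at j) (s at (j ∸ 1)))) (js k)

rule5 : {k : ℕ} → Vec ℕ k → List (Vec ℕ k)
rule5 {k} s =
  if 0 <ᵇ (s at (k ∸ 1)) then lastLabel s 0 ∷ lastLabel s 1 ∷ [] else []

children : {k : ℕ} → Vec ℕ k → List (Vec ℕ k)
children s = s ∷ inc0 s ∷ (rule34 s 0 ++ rule34 s 1 ++ rule5 s)

level : (k n : ℕ) → List (Vec ℕ k)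
level k zero    = replicate k 0 ∷ []
level k (suc n) = concatMap children (level k n)

-- Deleting the last vertex is a bijection between (k+1)-nonnesting diagrams of size n+1 and pairs
-- of a diagram of size n with an admissible way to add a vertex: the new vertex may open a semi-arc
-- and may close one existing semi-arc. Nestings are measured by depth g lo, the size of a largest
-- nesting with left end-points ≥ lo, so the nesting index of the semi-arc at a is depth g (a+1) and
-- s_m counts the semi-arcs of index ≥ m. Nesting indices decrease from left to right, hence the
-- semi-arcs of index j are exactly those with s_{j+1} ≤ rank < s_j. Closing the semi-arc of index j
-- and rank r gives the label of rule (3) or (4) for j+1 and i = r when j+1 < k; when j+1 ≥ k it
-- is admissible only for the leftmost semi-arc, which exists iff s_{k-1} > 0, giving rule (5).
-- So the labels of the admissible extensions of a diagram labelled s are the children of s with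
-- multiplicity, and by induction on n the diagrams of size n with label s match the nodes of
-- level n labelled s.

module Submission where

open import Defs

open import Axiom.UniquenessOfIdentityProofs.WithK using (uip)
open import Data.Bool using (Bool; true; false; if_then_else_; _∧_; not)
open import Data.Bool.Properties using (T-≡; ∧-zeroʳ; ∧-identityʳ)
open import Data.Empty using (⊥; ⊥-elim)
open import Data.Fin using (Fin; toℕ; fromℕ; inject₁) renaming (_<_ to _<ᶠ_)
import Data.Fin as F
import Data.Fin.Properties as FP
open import Data.List using (List; []; _∷_; map; concatMap; applyUpTo; length)
open import Data.List.Membership.Propositional using (_∈_)
open import Data.List.Membership.Propositional.Properties using (Any↔)
open import Data.List.Relation.Unary.Any using (Any; here; there)
open import Data.List.Relation.Unary.Any.Properties using (map↔; concat↔; ++↔; ∷↔; ⊥↔Any[])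
open import Data.Maybe using (Maybe; just; nothing)
import Data.Maybe as Maybe
open import Data.Maybe.Properties using (just-injective)
open import Data.Nat
  using (ℕ; zero; suc; _+_; _∸_; _≤_; _<_; z≤n; s≤s; _⊔_; _≤ᵇ_; _<ᵇ_; _≡ᵇ_; _≤?_; _<?_; _≟_)
open import Data.Nat.Properties
open import Algebra.Properties.CommutativeSemigroup +-commutativeSemigroup
  using () renaming (interchange to +-interchange)
import Data.Product.Function.Dependent.Propositional as Σ
open import Data.Product using (Σ; _×_; _,_; proj₁; proj₂)
open import Data.Product.Function.NonDependent.Propositional using (_×-cong_)
open import Data.Sum using (_⊎_; inj₁; inj₂)
open import Data.Sum.Function.Propositional using (_⊎-cong_)
open import Data.Unit using (⊤)
open import Data.Vec using (Vec; lookup; tabulate)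
import Data.Vec as Vec
import Data.Vec.Properties as VP
open import Function using (_∘_; case_of_)
open import Function.Bundles using (Equivalence; Inverse; _↔_; mk↔ₛ′)
open import Function.Properties.Inverse using (↔-refl; ↔-sym; ↔-trans)
open import Function.Related.Propositional using (K-reflexive; module EquationalReasoning)
open import Function.Related.TypeIsomorphisms using (Σ-assoc; ×-distribʳ-⊎; Σ-distribˡ-⊎)
open import Relation.Binary.Definitions using (tri<; tri≈; tri>)
open import Relation.Binary.PropositionalEquality
open import Relation.Nullary using (¬_; Dec; yes; no)
open import Relation.Nullary.Decidable using (recompute)

-- Sums, maxima and ranks over Fin
data LastView {n : ℕ} : Fin (suc n) → Set where
  last    : LastView (fromℕ n)
  earlier : (a : Fin n) → LastView (inject₁ a)

lastView : ∀ {n} (i : Fin (suc n)) → LastView i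
lastView {zero}  F.zero = last
lastView {suc n} F.zero = earlier F.zero
lastView {suc n} (F.suc i) with lastView i
... | last      = last
... | earlier a = earlier (F.suc a)

lastView-inject₁ : ∀ {n} (a : Fin n) → lastView (inject₁ a) ≡ earlier a
lastView-inject₁ {suc n} F.zero = refl
lastView-inject₁ {suc n} (F.suc a) rewrite lastView-inject₁ a = refl

lastView-fromℕ : ∀ n → lastView (fromℕ n) ≡ last
lastView-fromℕ zero = refl
lastView-fromℕ (suc n) rewrite lastView-fromℕ n = refl

∑ : ∀ n → (Fin n → ℕ) → ℕ
∑ zero    f = 0
∑ (suc n) f = ∑ n (f ∘ inject₁) + f (fromℕ n)

∑-cong : ∀ n {f g : Fin n → ℕ} → (∀ i → f i ≡ g i) → ∑ n f ≡ ∑ n g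
∑-cong zero    f≗g = refl
∑-cong (suc n) f≗g = cong₂ _+_ (∑-cong n (f≗g ∘ inject₁)) (f≗g (fromℕ n))

∑-mono : ∀ n {f g : Fin n → ℕ} → (∀ i → f i ≤ g i) → ∑ n f ≤ ∑ n g
∑-mono zero    f≤g = z≤n
∑-mono (suc n) f≤g = +-mono-≤ (∑-mono n (f≤g ∘ inject₁)) (f≤g (fromℕ n))

∑-+ : ∀ n (f g : Fin n → ℕ) → ∑ n (λ i → f i + g i) ≡ ∑ n f + ∑ n g
∑-+ zero    f g = refl
∑-+ (suc n) f g rewrite ∑-+ n (f ∘ inject₁) (g ∘ inject₁) =
  +-interchange (∑ n (f ∘ inject₁)) (∑ n (g ∘ inject₁)) (f (fromℕ n)) (g (fromℕ n))

∑-const-0 : ∀ n → ∑ n (λ _ → 0) ≡ 0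
∑-const-0 zero = refl
∑-const-0 (suc n) rewrite ∑-const-0 n = refl

∑-positive : ∀ n (f : Fin n → ℕ) → 0 < ∑ n f → Σ (Fin n) (λ i → 0 < f i)
∑-positive (suc n) f h with f (fromℕ n) in eq
... | suc _ = fromℕ n , subst (0 <_) (sym eq) (s≤s z≤n)
... | zero with ∑-positive n (f ∘ inject₁) (subst (0 <_) (+-identityʳ _) h)
...   | i , p = inject₁ i , p

pointMass : ∀ {n} → Fin n → Fin n → ℕ
pointMass a b with b F.≟ a
... | yes _ = 1
... | no  _ = 0

pointMass-self : ∀ {n} (a : Fin n) → pointMass a a ≡ 1
pointMass-self a with a F.≟ a
... | yes _ = refl
... | no a≢a = ⊥-elim (a≢a refl)

pointMass-other : ∀ {n} {a b : Fin n} → b ≢ a → pointMass a b ≡ 0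
pointMass-other {a = a} {b} b≢a with b F.≟ a
... | yes b≡a = ⊥-elim (b≢a b≡a)
... | no  _   = refl

∑-pointMass : ∀ n (a : Fin n) → ∑ n (pointMass a) ≡ 1
∑-pointMass (suc n) a with lastView a
... | last = begin
  ∑ n (pointMass (fromℕ n) ∘ inject₁) + pointMass (fromℕ n) (fromℕ n)
    ≡⟨ cong₂ _+_ (∑-cong n (λ b → pointMass-other (FP.fromℕ≢inject₁ ∘ sym))) (pointMass-self (fromℕ n)) ⟩
  ∑ n (λ _ → 0) + 1
    ≡⟨ cong (_+ 1) (∑-const-0 n) ⟩
  1 ∎
  where open ≡-Reasoning
... | earlier a′ = begin
  ∑ n (pointMass (inject₁ a′) ∘ inject₁) + pointMass (inject₁ a′) (fromℕ n)
    ≡⟨ cong₂ _+_ (∑-cong n (λ b → pointMass-inject₁ b)) (pointMass-other FP.fromℕ≢inject₁) ⟩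
  ∑ n (pointMass a′) + 0
    ≡⟨ +-identityʳ _ ⟩
  ∑ n (pointMass a′)
    ≡⟨ ∑-pointMass n a′ ⟩
  1 ∎
  where
  open ≡-Reasoning
  pointMass-inject₁ : ∀ b → pointMass (inject₁ a′) (inject₁ b) ≡ pointMass a′ b
  pointMass-inject₁ b with b F.≟ a′
  ... | yes refl = pointMass-self (inject₁ b)
  ... | no  b≢a′ = pointMass-other (b≢a′ ∘ FP.inject₁-injective)

∑-<-mono : ∀ n (a : Fin n) {f g : Fin n → ℕ} → (∀ b → f b + pointMass a b ≤ g b) → ∑ n f < ∑ n g
∑-<-mono n a {f} {g} h = begin-strict
  ∑ n f                          <⟨ n<1+n _ ⟩
  suc (∑ n f)                    ≡⟨ +-comm 1 (∑ n f) ⟩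
  ∑ n f + 1                      ≡⟨ cong (∑ n f +_) (∑-pointMass n a) ⟨
  ∑ n f + ∑ n (pointMass a)      ≡⟨ ∑-+ n f (pointMass a) ⟨
  ∑ n (λ b → f b + pointMass a b) ≤⟨ ∑-mono n h ⟩
  ∑ n g                          ∎
  where open ≤-Reasoning

⨆ : ∀ n → (Fin n → ℕ) → ℕ
⨆ zero    f = 0
⨆ (suc n) f = f F.zero ⊔ ⨆ n (f ∘ F.suc)

⨆-upper : ∀ n (f : Fin n → ℕ) i → f i ≤ ⨆ n f
⨆-upper (suc n) f F.zero    = m≤m⊔n _ _
⨆-upper (suc n) f (F.suc i) = ≤-trans (⨆-upper n (f ∘ F.suc) i) (m≤n⊔m _ _)

⨆-least : ∀ n (f : Fin n → ℕ) {x} → (∀ i → f i ≤ x) → ⨆ n f ≤ x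
⨆-least zero    f h = z≤n
⨆-least (suc n) f h = ⊔-lub (h F.zero) (⨆-least n (f ∘ F.suc) (h ∘ F.suc))

⨆-attained : ∀ n (f : Fin n → ℕ) {m} → m < ⨆ n f → Σ (Fin n) (λ i → m < f i)
⨆-attained (suc n) f h with ⊔-sel (f F.zero) (⨆ n (f ∘ F.suc))
... | inj₁ eq = F.zero , subst (_ <_) eq h
... | inj₂ eq with ⨆-attained n (f ∘ F.suc) (subst (_ <_) eq h)
...   | i , p = F.suc i , p

≤⇒≤ᵇ≡true : ∀ {m n} → m ≤ n → (m ≤ᵇ n) ≡ true
≤⇒≤ᵇ≡true m≤n = Equivalence.to T-≡ (≤⇒≤ᵇ m≤n)

≤ᵇ≡true⇒≤ : ∀ m n → (m ≤ᵇ n) ≡ true → m ≤ n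
≤ᵇ≡true⇒≤ m n eq = ≤ᵇ⇒≤ m n (Equivalence.from T-≡ eq)

>⇒≤ᵇ≡false : ∀ {m n} → n < m → (m ≤ᵇ n) ≡ false
>⇒≤ᵇ≡false {m} {n} n<m with m ≤ᵇ n in eq
... | true  = ⊥-elim (<⇒≱ n<m (≤ᵇ≡true⇒≤ m n eq))
... | false = refl

<⇒<ᵇ≡true : ∀ {m n} → m < n → (m <ᵇ n) ≡ true
<⇒<ᵇ≡true = ≤⇒≤ᵇ≡true

≥⇒<ᵇ≡false : ∀ {m n} → n ≤ m → (m <ᵇ n) ≡ false
≥⇒<ᵇ≡false n≤m = >⇒≤ᵇ≡false (s≤s n≤m)

≡ᵇ-refl : ∀ m → (m ≡ᵇ m) ≡ true
≡ᵇ-refl zero    = refl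
≡ᵇ-refl (suc m) = ≡ᵇ-refl m

≢⇒≡ᵇ≡false : ∀ {m n} → m ≢ n → (m ≡ᵇ n) ≡ false
≢⇒≡ᵇ≡false {zero}  {zero}  m≢n = ⊥-elim (m≢n refl)
≢⇒≡ᵇ≡false {zero}  {suc n} m≢n = refl
≢⇒≡ᵇ≡false {suc m} {zero}  m≢n = refl
≢⇒≡ᵇ≡false {suc m} {suc n} m≢n = ≢⇒≡ᵇ≡false (m≢n ∘ cong suc)

guard : Bool → ℕ → ℕ
guard true  x = x
guard false x = 0

guard-≤ : ∀ b x → guard b x ≤ x
guard-≤ true  x = ≤-refl
guard-≤ false x = z≤n

guard-positive : ∀ b x {m} → m < guard b x → b ≡ true × m < x
guard-positive true x h = refl , h

𝟙 : Bool → ℕ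
𝟙 true  = 1
𝟙 false = 0

𝟙≤1 : ∀ b → 𝟙 b ≤ 1
𝟙≤1 true  = ≤-refl
𝟙≤1 false = z≤n

𝟙-positive : ∀ x y → 0 < 𝟙 (x ∧ y) → x ≡ true × y ≡ true
𝟙-positive true true _ = refl , refl

count : ∀ n → (Fin n → Bool) → ℕ
count n p = ∑ n (𝟙 ∘ p)

rank : ∀ n → (Fin n → Bool) → Fin n → ℕ
rank n p a = count n (λ b → p b ∧ (suc (toℕ b) ≤ᵇ toℕ a))

rank-<-mono : ∀ n (p : Fin n → Bool) {a a′} → p a ≡ true → toℕ a < toℕ a′ → rank n p a < rank n p a′
rank-<-mono n p {a} {a′} pa a<a′ = ∑-<-mono n a pointwise
  where
  pointwise : ∀ b → 𝟙 (p b ∧ (suc (toℕ b) ≤ᵇ toℕ a)) + pointMass a b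
                  ≤ 𝟙 (p b ∧ (suc (toℕ b) ≤ᵇ toℕ a′))
  pointwise b with b F.≟ a
  ... | yes refl rewrite pa | >⇒≤ᵇ≡false (n<1+n (toℕ b)) | ≤⇒≤ᵇ≡true a<a′ = ≤-refl
  ... | no _ with p b | suc (toℕ b) ≤ᵇ toℕ a in b<a
  ...   | false | _     = z≤n
  ...   | true  | false = z≤n
  ...   | true  | true rewrite ≤⇒≤ᵇ≡true (<-trans (≤ᵇ≡true⇒≤ _ _ b<a) a<a′) = ≤-refl

rank-injective : ∀ n (p : Fin n → Bool) {a a′} → p a ≡ true → p a′ ≡ true →
  rank n p a ≡ rank n p a′ → a ≡ a′
rank-injective n p {a} {a′} pa pa′ eq with <-cmp (toℕ a) (toℕ a′)
... | tri< a<a′ _ _ = ⊥-elim (<-irrefl eq (rank-<-mono n p pa a<a′))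
... | tri≈ _ a≡a′ _ = FP.toℕ-injective a≡a′
... | tri> _ _ a′<a = ⊥-elim (<-irrefl (sym eq) (rank-<-mono n p pa′ a′<a))

rank-inject₁ : ∀ n (p : Fin (suc n) → Bool) a → rank (suc n) p (inject₁ a) ≡ rank n (p ∘ inject₁) a
rank-inject₁ n p a = begin
  ∑ n (λ b → 𝟙 (p (inject₁ b) ∧ (suc (toℕ (inject₁ b)) ≤ᵇ toℕ (inject₁ a))))
    + 𝟙 (p (fromℕ n) ∧ (suc (toℕ (fromℕ n)) ≤ᵇ toℕ (inject₁ a)))
    ≡⟨ cong₂ _+_ (∑-cong n λ b → cong₂ (λ x y → 𝟙 (p (inject₁ b) ∧ (suc x ≤ᵇ y)))
                                       (FP.toℕ-inject₁ b) (FP.toℕ-inject₁ a))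
                 (cong (λ x → 𝟙 (p (fromℕ n) ∧ x)) (>⇒≤ᵇ≡false last>a)) ⟩
  rank n (p ∘ inject₁) a + 𝟙 (p (fromℕ n) ∧ false)
    ≡⟨ cong (λ x → rank n (p ∘ inject₁) a + 𝟙 x) (∧-zeroʳ (p (fromℕ n))) ⟩
  rank n (p ∘ inject₁) a + 0
    ≡⟨ +-identityʳ _ ⟩
  rank n (p ∘ inject₁) a ∎
  where
  open ≡-Reasoning
  last>a : toℕ (inject₁ a) < suc (toℕ (fromℕ n))
  last>a = s≤s (subst₂ _≤_ (sym (FP.toℕ-inject₁ a)) (sym (FP.toℕ-fromℕ n)) (<⇒≤ (FP.toℕ<n a)))

rank-fromℕ : ∀ n (p : Fin (suc n) → Bool) → rank (suc n) p (fromℕ n) ≡ count n (p ∘ inject₁)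
rank-fromℕ n p = begin
  ∑ n (λ b → 𝟙 (p (inject₁ b) ∧ (suc (toℕ (inject₁ b)) ≤ᵇ toℕ (fromℕ n))))
    + 𝟙 (p (fromℕ n) ∧ (suc (toℕ (fromℕ n)) ≤ᵇ toℕ (fromℕ n)))
    ≡⟨ cong₂ _+_ (∑-cong n λ b → cong (λ x → 𝟙 (p (inject₁ b) ∧ x)) (≤⇒≤ᵇ≡true (b<last b)))
                 (cong (λ x → 𝟙 (p (fromℕ n) ∧ x)) (>⇒≤ᵇ≡false (n<1+n (toℕ (fromℕ n))))) ⟩
  ∑ n (λ b → 𝟙 (p (inject₁ b) ∧ true)) + 𝟙 (p (fromℕ n) ∧ false)
    ≡⟨ cong₂ _+_ (∑-cong n λ b → cong 𝟙 (∧-identityʳ _)) (cong 𝟙 (∧-zeroʳ (p (fromℕ n)))) ⟩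
  count n (p ∘ inject₁) + 0
    ≡⟨ +-identityʳ _ ⟩
  count n (p ∘ inject₁) ∎
  where
  open ≡-Reasoning
  b<last : ∀ b → suc (toℕ (inject₁ b)) ≤ toℕ (fromℕ n)
  b<last b = subst₂ _<_ (sym (FP.toℕ-inject₁ b)) (sym (FP.toℕ-fromℕ n)) (FP.toℕ<n b)

unrank : ∀ n (p : Fin n → Bool) {r} → r < count n p → Σ (Fin n) (λ a → p a ≡ true × rank n p a ≡ r)
unrank (suc n) p {r} r<count with r <? count n (p ∘ inject₁)
... | yes r<count′ with unrank n (p ∘ inject₁) r<count′
...   | a , pa , rank≡r = inject₁ a , pa , trans (rank-inject₁ n p a) rank≡r
unrank (suc n) p {r} r<count | no r≮count′ = fromℕ n , p-last , trans (rank-fromℕ n p) count′≡r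
  where
  selected : ∀ b → r < count n (p ∘ inject₁) + 𝟙 b → b ≡ true
  selected true  _ = refl
  selected false h = ⊥-elim (r≮count′ (subst (r <_) (+-identityʳ _) h))
  p-last : p (fromℕ n) ≡ true
  p-last = selected (p (fromℕ n)) r<count
  count′≡r : count n (p ∘ inject₁) ≡ r
  count′≡r = ≤-antisym (≮⇒≥ r≮count′)
    (≤-pred (subst (r <_) (trans (cong (λ x → count n (p ∘ inject₁) + 𝟙 x) p-last) (+-comm _ 1)) r<count))

find : ∀ n → (Fin n → Bool) → Maybe (Fin n)
find zero    p = nothing
find (suc n) p with p F.zero
... | true  = just F.zero
... | false = Maybe.map F.suc (find n (p ∘ F.suc))

find-just : ∀ n (p : Fin n → Bool) {a} → find n p ≡ just a → p a ≡ true
find-just (suc n) p eq with p F.zero in p0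
find-just (suc n) p refl | true = p0
... | false with find n (p ∘ F.suc) in eq′
find-just (suc n) p refl | false | just b = find-just n (p ∘ F.suc) eq′

find-nothing : ∀ n (p : Fin n → Bool) → find n p ≡ nothing → ∀ a → p a ≡ false
find-nothing (suc n) p eq a with p F.zero in p0
... | false with find n (p ∘ F.suc) in eq′
find-nothing (suc n) p refl F.zero    | false | nothing = p0
find-nothing (suc n) p refl (F.suc a) | false | nothing = find-nothing n (p ∘ F.suc) eq′ a

find-characterised : ∀ n (p : Fin n → Bool) c →
  (∀ a → p a ≡ true → c ≡ just a) → (∀ a → c ≡ just a → p a ≡ true) → find n p ≡ c
find-characterised n p c p⇒c c⇒p with find n p in eq
... | just a = sym (p⇒c a (find-just n p eq))
... | nothing with c
...   | nothing = refl
...   | just a  = case trans (sym (find-nothing n p eq a)) (c⇒p a refl) of λ ()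

suc<⇒<∸1 : ∀ {j m} → suc j < m → j < m ∸ 1
suc<⇒<∸1 {m = suc m} = ≤-pred

<∸1⇒suc< : ∀ {j m} → j < m ∸ 1 → suc j < m
<∸1⇒suc< {m = suc m} = s≤s

<∸⇒+< : ∀ {i m N} → i < N ∸ m → m + i < N
<∸⇒+< {i} {m} {N} i<N∸m with m ≤? N
... | yes m≤N = subst (m + i <_) (m+[n∸m]≡n m≤N) (+-monoʳ-< m i<N∸m)
... | no  m≰N = ⊥-elim (n≮0 (subst (i <_) (m≤n⇒m∸n≡0 (<⇒≤ (≰⇒> m≰N))) i<N∸m))

at-tabulate : ∀ k (S : ℕ → ℕ) j → j < k → tabulate {n = k} (S ∘ toℕ) at j ≡ S j
at-tabulate (suc k) S zero    _   = refl
at-tabulate (suc k) S (suc j) j<k = at-tabulate k (S ∘ suc) j (≤-pred j<k)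

+1≡+𝟙⇒≡∸𝟙not : ∀ x y o → x + 1 ≡ y + 𝟙 o → x ≡ y ∸ 𝟙 (not o)
+1≡+𝟙⇒≡∸𝟙not x y true  eq = +-cancelʳ-≡ 1 x y eq
+1≡+𝟙⇒≡∸𝟙not x y false eq = sym (trans (cong (_∸ 1) (sym (trans eq (+-identityʳ y)))) (m+n∸n≡m x 1))

≡-flip↔ : ∀ {A : Set} {x y z : A} → x ≡ y → (x ≡ z) ↔ (z ≡ y)
≡-flip↔ x≡y = mk↔ₛ′ (λ x≡z → trans (sym x≡z) x≡y) (λ z≡y → trans x≡y (sym z≡y))
  (λ _ → uip _ _) (λ _ → uip _ _)

Σ-contractible↔ : ∀ {A : Set} {P : A → Set} (c : A) → (∀ x → c ≡ x) → Σ A P ↔ P c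
Σ-contractible↔ {P = P} c contract = mk↔ₛ′ (λ { (x , p) → subst P (sym (contract x)) p }) (c ,_)
  (λ p → cong (λ e → subst P e p) (uip (sym (contract c)) refl))
  (λ { (x , p) → lemma (contract x) p })
  where
  lemma : ∀ {x} (c≡x : c ≡ x) (p : P x) → (c , subst P (sym c≡x) p) ≡ (x , p)
  lemma refl p = refl

¬⇒↔⊥ : ∀ {A : Set} → ¬ A → A ↔ ⊥
¬⇒↔⊥ ¬a = mk↔ₛ′ ¬a (λ ()) (λ ()) (λ a → ⊥-elim (¬a a))

⊎-⊥↔ : ∀ {A : Set} → (A ⊎ ⊥) ↔ A
⊎-⊥↔ = mk↔ₛ′ (λ { (inj₁ a) → a ; (inj₂ ()) }) inj₁
  (λ _ → refl) (λ { (inj₁ _) → refl ; (inj₂ ()) })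

⊎-interchange : ∀ {A B C D : Set} → ((A ⊎ B) ⊎ (C ⊎ D)) ↔ (A ⊎ C ⊎ B ⊎ D)
⊎-interchange = mk↔ₛ′
  (λ { (inj₁ (inj₁ a)) → inj₁ a ; (inj₁ (inj₂ b)) → inj₂ (inj₂ (inj₁ b))
     ; (inj₂ (inj₁ c)) → inj₂ (inj₁ c) ; (inj₂ (inj₂ d)) → inj₂ (inj₂ (inj₂ d)) })
  (λ { (inj₁ a) → inj₁ (inj₁ a) ; (inj₂ (inj₁ c)) → inj₂ (inj₁ c)
     ; (inj₂ (inj₂ (inj₁ b))) → inj₁ (inj₂ b) ; (inj₂ (inj₂ (inj₂ d))) → inj₂ (inj₂ d) })
  (λ { (inj₁ _) → refl ; (inj₂ (inj₁ _)) → refl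
     ; (inj₂ (inj₂ (inj₁ _))) → refl ; (inj₂ (inj₂ (inj₂ _))) → refl })
  (λ { (inj₁ (inj₁ _)) → refl ; (inj₁ (inj₂ _)) → refl
     ; (inj₂ (inj₁ _)) → refl ; (inj₂ (inj₂ _)) → refl })

Any-applyUpTo↔ : ∀ {A : Set} {P : A → Set} (f : ℕ → A) m →
  Any P (applyUpTo f m) ↔ Σ ℕ (λ i → i < m × P (f i))
Any-applyUpTo↔ f zero = mk↔ₛ′ (λ ()) (λ { (_ , () , _) }) (λ { (_ , () , _) }) (λ ())
Any-applyUpTo↔ {P = P} f (suc m) =
  ↔-trans (↔-sym (∷↔ P)) (↔-trans (↔-refl ⊎-cong Any-applyUpTo↔ (f ∘ suc) m) first-or-later)
  where
  first-or-later : (P (f 0) ⊎ Σ ℕ (λ i → i < m × P (f (suc i)))) ↔ Σ ℕ (λ i → i < suc m × P (f i))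
  first-or-later = mk↔ₛ′
    (λ { (inj₁ p) → 0 , s≤s z≤n , p ; (inj₂ (i , i<m , p)) → suc i , s≤s i<m , p })
    (λ { (zero , _ , p) → inj₁ p ; (suc i , s≤s i<m , p) → inj₂ (i , i<m , p) })
    (λ { (zero , s≤s z≤n , p) → refl ; (suc i , s≤s i<m , p) → refl })
    (λ { (inj₁ p) → refl ; (inj₂ _) → refl })

Any-range↔ : ∀ {P : ℕ → Set} a b → Any P (range a b) ↔ Σ ℕ (λ i → i < b ∸ a × P (a + i))
Any-range↔ a b = ↔-trans (↔-sym map↔) (Any-applyUpTo↔ (λ i → i) (b ∸ a))

Any-concatMap↔ : ∀ {A B : Set} {P : B → Set} (f : A → List B) xs → Any P (concatMap f xs) ↔ Any (Any P ∘ f) xs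
Any-concatMap↔ f xs = ↔-trans (↔-sym concat↔) (↔-sym map↔)

∈-Fin-length↔ : ∀ {A : Set} (xs : List A) → Σ A (_∈ xs) ↔ Fin (length xs)
∈-Fin-length↔ []       = mk↔ₛ′ (λ { (_ , ()) }) (λ ()) (λ ()) (λ { (_ , ()) })
∈-Fin-length↔ (y ∷ xs) = mk↔ₛ′ to from to∘from from∘to
  where
  open Inverse (∈-Fin-length↔ xs) renaming (to to to′; from to from′)
  to : Σ _ (_∈ y ∷ xs) → Fin (suc (length xs))
  to (_ , here refl) = F.zero
  to (x , there x∈) = F.suc (to′ (x , x∈))
  from : Fin (suc (length xs)) → Σ _ (_∈ y ∷ xs)
  from F.zero    = y , here refl
  from (F.suc i) = proj₁ (from′ i) , there (proj₂ (from′ i))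
  to∘from : ∀ i → to (from i) ≡ i
  to∘from F.zero    = refl
  to∘from (F.suc i) = cong F.suc (strictlyInverseˡ i)
  from∘to : ∀ x → from (to x) ≡ x
  from∘to (_ , here refl) = refl
  from∘to (x , there x∈) rewrite strictlyInverseʳ (x , x∈) = refl

partition↔ : ∀ {A B : Set} (f : A → B) → A ↔ Σ B (λ b → Σ A (λ a → f a ≡ b))
partition↔ f = mk↔ₛ′ (λ a → f a , a , refl) (λ { (_ , a , _) → a })
  (λ { (_ , _ , refl) → refl }) (λ _ → refl)

Σ-fibres↔ : ∀ {A B : Set} (f : A → B) {R : B → Set} →
  Σ A (R ∘ f) ↔ Σ B (λ b → Σ A (λ a → f a ≡ b) × R b)
Σ-fibres↔ f = mk↔ₛ′ (λ { (a , r) → f a , (a , refl) , r }) (λ { (_ , (a , refl) , r) → a , r })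
  (λ { (_ , (_ , refl) , _) → refl }) (λ { (_ , _) → refl })

-- Nesting depth
Outs : ℕ → Set
Outs n = Fin n → Out n

-- Deleting the last vertex turns an arc ending there into a semi-arc.
restrictTarget : ∀ {n} {b : Fin (suc n)} → LastView b → Out n
restrictTarget last        = semi
restrictTarget (earlier b) = arc b

restrictOut : ∀ {n} → Out (suc n) → Out n
restrictOut none    = none
restrictOut semi    = semi
restrictOut (arc b) = restrictTarget (lastView b)

restrict : ∀ {n} → Outs (suc n) → Outs n
restrict g a = restrictOut (g (inject₁ a))

endsAtLast : ∀ {n} → Out (suc n) → Bool
endsAtLast (arc b) with lastView b
... | last      = true
... | earlier _ = false
endsAtLast _ = false

endsAtLast-fromℕ : ∀ n → endsAtLast {n} (arc (fromℕ n)) ≡ true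
endsAtLast-fromℕ n rewrite lastView-fromℕ n = refl

endsAtLast-true : ∀ {n} (o : Out (suc n)) → endsAtLast o ≡ true → o ≡ arc (fromℕ n)
endsAtLast-true (arc b) eq with lastView b
endsAtLast-true (arc _) eq | last      = refl
endsAtLast-true (arc _) () | earlier _

restrict-arc : ∀ {n} (g : Outs (suc n)) a b → g (inject₁ a) ≡ arc (inject₁ b) → restrict g a ≡ arc b
restrict-arc g a b eq rewrite eq | lastView-inject₁ b = refl

restrict-arc⁻¹ : ∀ {n} (g : Outs (suc n)) a b → restrict g a ≡ arc b → g (inject₁ a) ≡ arc (inject₁ b)
restrict-arc⁻¹ g a b eq with g (inject₁ a)
restrict-arc⁻¹ g a b () | none
restrict-arc⁻¹ g a b () | semi
... | arc c with lastView c
restrict-arc⁻¹ g a b ()   | arc _ | last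
restrict-arc⁻¹ g a b refl | arc _ | earlier _ = refl

-- depth n g lo is the size of a largest nesting of g all of whose left end-points are ≥ lo:
-- such a nesting either avoids the last vertex, or its outermost arc is some (a, last).
depth : ∀ n → Outs n → ℕ → ℕ
depthThrough : ∀ n → Outs (suc n) → ℕ → Fin n → ℕ

depth zero    g lo = 0
depth (suc n) g lo = depth n (restrict g) lo ⊔ ⨆ n (depthThrough n g lo)

depthThrough n g lo a =
  guard (endsAtLast (g (inject₁ a))) (guard (lo ≤ᵇ toℕ a) (suc (depth n (restrict g) (suc (toℕ a)))))

data Nested {n : ℕ} (g : Outs n) : ℕ → ℕ → ℕ → Set where
  empty  : ∀ {lo hi} → Nested g 0 lo hi
  around : ∀ {m lo hi} (a b : Fin n) → g a ≡ arc b → lo ≤ toℕ a → toℕ a < toℕ b → toℕ b < hi →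
           Nested g m (suc (toℕ a)) (toℕ b) → Nested g (suc m) lo hi

Nested-cong : ∀ {n} {g h : Outs n} → (∀ i → g i ≡ h i) → ∀ {m lo hi} → Nested g m lo hi → Nested h m lo hi
Nested-cong g≗h empty = empty
Nested-cong g≗h (around a b ab p q r N) = around a b (trans (sym (g≗h a)) ab) p q r (Nested-cong g≗h N)

Nested-lowerˡ : ∀ {n} {g : Outs n} {m lo lo′ hi} → lo′ ≤ lo → Nested g m lo hi → Nested g m lo′ hi
Nested-lowerˡ le empty = empty
Nested-lowerˡ le (around a b ab p q r N) = around a b ab (≤-trans le p) q r N

Nested-raiseʳ : ∀ {n} {g : Outs n} {m lo hi hi′} → hi ≤ hi′ → Nested g m lo hi → Nested g m lo hi′
Nested-raiseʳ le empty = empty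
Nested-raiseʳ le (around a b ab p q r N) = around a b ab p q (<-≤-trans r le) N

below-last : ∀ {n} (i : Fin (suc n)) → toℕ i < n → Σ (Fin n) (λ j → inject₁ j ≡ i)
below-last i i<n with lastView i
... | last      = ⊥-elim (<-irrefl (FP.toℕ-fromℕ _) i<n)
... | earlier j = j , refl

Nested-restrict : ∀ {n} (g : Outs (suc n)) {m lo hi} → hi ≤ n → Nested g m lo hi → Nested (restrict g) m lo hi
Nested-restrict g le empty = empty
Nested-restrict g {suc m} {lo} {hi} le (around a b ab p q r N)
  with below-last b (<-≤-trans r le)
... | b′ , refl with below-last a (<-trans q (<-≤-trans r le))
... | a′ , refl =
  around a′ b′ (restrict-arc g a′ b′ ab)
    (subst (lo ≤_) (FP.toℕ-inject₁ a′) p)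
    (subst₂ _<_ (FP.toℕ-inject₁ a′) (FP.toℕ-inject₁ b′) q)
    (subst (_< hi) (FP.toℕ-inject₁ b′) r)
    (subst₂ (Nested (restrict g) m) (cong suc (FP.toℕ-inject₁ a′)) (FP.toℕ-inject₁ b′)
      (Nested-restrict g (<⇒≤ (<-≤-trans r le)) N))

Nested-unrestrict : ∀ {n} (g : Outs (suc n)) {m lo hi} → Nested (restrict g) m lo hi → Nested g m lo hi
Nested-unrestrict g empty = empty
Nested-unrestrict g {suc m} {lo} {hi} (around a b ab p q r N) =
  around (inject₁ a) (inject₁ b) (restrict-arc⁻¹ g a b ab)
    (subst (lo ≤_) (sym (FP.toℕ-inject₁ a)) p)
    (subst₂ _<_ (sym (FP.toℕ-inject₁ a)) (sym (FP.toℕ-inject₁ b)) q)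
    (subst (_< hi) (sym (FP.toℕ-inject₁ b)) r)
    (subst₂ (Nested g m) (cong suc (sym (FP.toℕ-inject₁ a))) (sym (FP.toℕ-inject₁ b)) (Nested-unrestrict g N))

Nested-aroundLast : ∀ {n} (g : Outs (suc n)) {m lo} (a : Fin n) → g (inject₁ a) ≡ arc (fromℕ n) → lo ≤ toℕ a →
  Nested (restrict g) m (suc (toℕ a)) n → Nested g (suc m) lo (suc n)
Nested-aroundLast {n} g {m} {lo} a a-last lo≤a N =
  around (inject₁ a) (fromℕ n) a-last
    (subst (lo ≤_) (sym (FP.toℕ-inject₁ a)) lo≤a)
    (subst₂ _<_ (sym (FP.toℕ-inject₁ a)) (sym (FP.toℕ-fromℕ n)) (FP.toℕ<n a))
    (subst (_< suc n) (sym (FP.toℕ-fromℕ n)) (n<1+n n))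
    (subst₂ (Nested g m) (cong suc (sym (FP.toℕ-inject₁ a))) (sym (FP.toℕ-fromℕ n)) (Nested-unrestrict g N))

depth-sound : ∀ n (g : Outs n) {m lo hi} → Nested g m lo hi → m ≤ depth n g lo
depth-sound zero    g empty = z≤n
depth-sound zero    g (around () _ _ _ _ _ _)
depth-sound (suc n) g empty = z≤n
depth-sound (suc n) g {suc m} {lo} (around a b ab p q r N) with lastView b
... | earlier b′ =
  ≤-trans (depth-sound n (restrict g) (Nested-restrict g ≤-refl
            (around {hi = n} a (inject₁ b′) ab p q (subst (_< n) (sym (FP.toℕ-inject₁ b′)) (FP.toℕ<n b′)) N)))
          (m≤m⊔n _ _)
... | last with below-last a (subst (toℕ a <_) (FP.toℕ-fromℕ n) q)
... | a′ , refl = ≤-trans (≤-trans through-a′ (⨆-upper n _ a′)) (m≤n⊔m _ _)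
  where
  N′ : Nested (restrict g) m (suc (toℕ a′)) n
  N′ = Nested-restrict g ≤-refl (subst₂ (Nested g m) (cong suc (FP.toℕ-inject₁ a′)) (FP.toℕ-fromℕ n) N)
  through-a′ : suc m ≤ depthThrough n g lo a′
  through-a′ rewrite ab | endsAtLast-fromℕ n | ≤⇒≤ᵇ≡true (subst (lo ≤_) (FP.toℕ-inject₁ a′) p) =
    s≤s (depth-sound n (restrict g) N′)

depth-complete : ∀ n (g : Outs n) m lo → m ≤ depth n g lo → Nested g m lo n
depth-complete n       g zero    lo h = empty
depth-complete (suc n) g (suc m) lo h with ⊔-sel (depth n (restrict g) lo) (⨆ n _)
... | inj₁ eq = Nested-raiseʳ (n≤1+n n)
                  (Nested-unrestrict g (depth-complete n (restrict g) (suc m) lo (subst (_ ≤_) eq h)))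
... | inj₂ eq with ⨆-attained n _ (subst (_ ≤_) eq h)
... | a , h′ with guard-positive (endsAtLast (g (inject₁ a))) _ h′
... | a-last , h″ with guard-positive (lo ≤ᵇ toℕ a) _ h″
... | lo≤a , h‴ =
  Nested-aroundLast g a (endsAtLast-true _ a-last) (≤ᵇ≡true⇒≤ lo (toℕ a) lo≤a)
    (depth-complete n (restrict g) m (suc (toℕ a)) (≤-pred h‴))

depth-cong : ∀ n {g h : Outs n} → (∀ i → g i ≡ h i) → ∀ lo → depth n g lo ≡ depth n h lo
depth-cong n g≗h lo = ≤-antisym
  (depth-sound n _ (Nested-cong g≗h (depth-complete n _ _ lo ≤-refl)))
  (depth-sound n _ (Nested-cong (sym ∘ g≗h) (depth-complete n _ _ lo ≤-refl)))

depth-antitone : ∀ n (g : Outs n) {lo lo′} → lo ≤ lo′ → depth n g lo′ ≤ depth n g lo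
depth-antitone n g le = depth-sound n g (Nested-lowerˡ le (depth-complete n g _ _ ≤-refl))

depth-beyond : ∀ n (g : Outs n) lo → n ≤ lo → depth n g lo ≡ 0
depth-beyond n g lo n≤lo with depth n g lo in eq
... | zero  = refl
... | suc _ with depth-complete n g 1 lo (subst (1 ≤_) (sym eq) (s≤s z≤n))
... | around a _ _ lo≤a _ _ _ = ⊥-elim (<-irrefl refl (≤-<-trans (≤-trans n≤lo lo≤a) (FP.toℕ<n a)))

-- Adding a last vertex
_≟ₒ_ : ∀ {n} (x y : Out n) → Dec (x ≡ y)
none  ≟ₒ none  = yes refl
semi  ≟ₒ semi  = yes refl
arc b ≟ₒ arc c with b F.≟ c
... | yes refl = yes refl
... | no  b≢c  = no λ { refl → b≢c refl }
none  ≟ₒ semi  = no λ ()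
none  ≟ₒ arc _ = no λ ()
semi  ≟ₒ none  = no λ ()
semi  ≟ₒ arc _ = no λ ()
arc _ ≟ₒ none  = no λ ()
arc _ ≟ₒ semi  = no λ ()

record Step (n : ℕ) : Set where
  constructor step
  field
    opens  : Bool
    closes : Maybe (Fin n)

ClosesSemi : ∀ {n} → Outs n → Maybe (Fin n) → Set
ClosesSemi g nothing  = ⊤
ClosesSemi g (just c) = g c ≡ semi

closesSemi? : ∀ {n} (g : Outs n) c → Dec (ClosesSemi g c)
closesSemi? g nothing  = yes _
closesSemi? g (just c) = g c ≟ₒ semi

closeAt : ∀ {n} {a c : Fin n} → Dec (a ≡ c) → Out (suc n)
closeAt (yes _) = arc (fromℕ _)
closeAt (no _)  = semi

extendOut : ∀ {n} → Maybe (Fin n) → Fin n → Out n → Out (suc n)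
extendOut c        a none    = none
extendOut c        a (arc b) = arc (inject₁ b)
extendOut nothing  a semi    = semi
extendOut (just c) a semi    = closeAt (a F.≟ c)

extendAt : ∀ {n} → Outs n → Step n → {i : Fin (suc n)} → LastView i → Out (suc n)
extendAt g (step o c) last        = if o then semi else none
extendAt g (step o c) (earlier a) = extendOut c a (g a)

extend : ∀ {n} → Outs n → Step n → Outs (suc n)
extend g s i = extendAt g s (lastView i)

extend-inject₁ : ∀ {n} (g : Outs n) s a → extend g s (inject₁ a) ≡ extendOut (Step.closes s) a (g a)
extend-inject₁ g (step o c) a rewrite lastView-inject₁ a = refl

extend-fromℕ : ∀ {n} (g : Outs n) s → extend g s (fromℕ n) ≡ (if Step.opens s then semi else none)
extend-fromℕ {n} g (step o c) rewrite lastView-fromℕ n = refl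

extendOut-semi-other : ∀ {n} {a b : Fin n} → b ≢ a → extendOut (just a) b semi ≡ semi
extendOut-semi-other {a = a} {b} b≢a with b F.≟ a
... | yes b≡a = ⊥-elim (b≢a b≡a)
... | no  _   = refl

extendOut-semi : ∀ {n} c (a : Fin n) o → extendOut c a o ≡ semi → o ≡ semi
extendOut-semi c a semi _ = refl
extendOut-semi c a none    ()
extendOut-semi c a (arc _) ()

restrict-extendOut : ∀ {n} c (a : Fin n) o → restrictOut (extendOut c a o) ≡ o
restrict-extendOut c        a none    = refl
restrict-extendOut c        a (arc b) rewrite lastView-inject₁ b = refl
restrict-extendOut nothing  a semi    = refl
restrict-extendOut {n} (just c) a semi with a F.≟ c
... | yes _ rewrite lastView-fromℕ n = refl
... | no  _ = refl

restrict-extend : ∀ {n} (g : Outs n) s a → restrict (extend g s) a ≡ g a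
restrict-extend g s a rewrite extend-inject₁ g s a = restrict-extendOut (Step.closes s) a (g a)

endsAtLast-extendOut : ∀ {n} c (a : Fin n) o → endsAtLast (extendOut c a o) ≡ true → c ≡ just a
endsAtLast-extendOut c        a (arc b) eq rewrite lastView-inject₁ b = case eq of λ ()
endsAtLast-extendOut (just c) a semi    eq with a F.≟ c
... | yes refl = refl

endsAtLast-closing : ∀ {n} (c : Fin n) → endsAtLast (extendOut (just c) c semi) ≡ true
endsAtLast-closing {n} c with c F.≟ c
... | yes _   = endsAtLast-fromℕ n
... | no  c≢c = ⊥-elim (c≢c refl)

-- The nestings created by closing the semi-arc at c all have (c, last) as outermost arc.
closing : ∀ {n} → Outs n → Maybe (Fin n) → ℕ → ℕ
closing     g nothing  lo = 0
closing {n} g (just c) lo = guard (lo ≤ᵇ toℕ c) (suc (depth n g (suc (toℕ c))))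

depth-extend : ∀ n (g : Outs n) s → ClosesSemi g (Step.closes s) → ∀ lo →
  depth (suc n) (extend g s) lo ≡ depth n g lo ⊔ closing g (Step.closes s) lo
depth-extend n g s@(step o c) c-semi lo =
  cong₂ _⊔_ (depth-cong n (restrict-extend g s) lo) (≤-antisym (⨆-least n _ through≤closing) (closing≤⨆ c c-semi))
  where
  through≡ : ∀ s a → depthThrough n (extend g s) lo a
    ≡ guard (endsAtLast (extendOut (Step.closes s) a (g a))) (guard (lo ≤ᵇ toℕ a) (suc (depth n g (suc (toℕ a)))))
  through≡ s a rewrite extend-inject₁ g s a | depth-cong n (restrict-extend g s) (suc (toℕ a)) = refl
  through≤closing : ∀ a → depthThrough n (extend g s) lo a ≤ closing g c lo
  through≤closing a rewrite through≡ s a with endsAtLast (extendOut c a (g a)) in eq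
  ... | false = z≤n
  ... | true with endsAtLast-extendOut c a (g a) eq
  ...   | refl = ≤-refl
  closing≤⨆ : ∀ c → ClosesSemi g c → closing g c lo ≤ ⨆ n (depthThrough n (extend g (step o c)) lo)
  closing≤⨆ nothing  _      = z≤n
  closing≤⨆ (just c) c-semi = ≤-trans (≤-reflexive closing≡) (⨆-upper n _ c)
    where
    closing≡ : closing g (just c) lo ≡ depthThrough n (extend g (step o (just c))) lo c
    closing≡ rewrite through≡ (step o (just c)) c | c-semi | endsAtLast-closing c = refl

outs : ∀ {n} → OpenPartitionDiagram n → Outs n
outs d = lookup (out d)

Nesting-tail : ∀ {n} {d : OpenPartitionDiagram n} {m} → Nesting d (suc m) → Nesting d m
Nesting-tail N = record
  { lefts             = lefts N ∘ F.suc
  ; rights            = rights N ∘ F.suc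
  ; isArc             = isArc N ∘ F.suc
  ; lefts-increasing  = λ t u t<u → lefts-increasing N (F.suc t) (F.suc u) (s≤s t<u)
  ; rights-decreasing = λ t u t<u → rights-decreasing N (F.suc t) (F.suc u) (s≤s t<u)
  ; inner             = inner N ∘ F.suc
  }

Nesting⇒Nested : ∀ {n} (d : OpenPartitionDiagram n) {m} (N : Nesting d m) {lo hi} →
  (∀ t → lo ≤ toℕ (lefts N t)) → (∀ t → toℕ (rights N t) < hi) → Nested (outs d) m lo hi
Nesting⇒Nested d {zero}  N lo≤ <hi = empty
Nesting⇒Nested d {suc m} N lo≤ <hi =
  around (lefts N F.zero) (rights N F.zero) (isArc N F.zero) (lo≤ F.zero) (inner N F.zero) (<hi F.zero)
    (Nesting⇒Nested d (Nesting-tail N)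
      (λ t → lefts-increasing N F.zero (F.suc t) (s≤s z≤n))
      (λ t → rights-decreasing N F.zero (F.suc t) (s≤s z≤n)))

Nesting⇒Nested′ : ∀ {n} (d : OpenPartitionDiagram n) {m} (N : Nesting d m) {lo} →
  (∀ t → lo ≤ toℕ (lefts N t)) → Nested (outs d) m lo n
Nesting⇒Nested′ d N lo≤ = Nesting⇒Nested d N lo≤ (λ t → FP.toℕ<n (rights N t))

BoundedNesting : ∀ {n} → OpenPartitionDiagram n → ℕ → ℕ → ℕ → Set
BoundedNesting d m lo hi =
  Σ (Nesting d m) (λ N → (∀ t → lo ≤ toℕ (lefts N t)) × (∀ t → toℕ (rights N t) < hi))

Nested⇒Nesting : ∀ {n} (d : OpenPartitionDiagram n) {m lo hi} → Nested (outs d) m lo hi → BoundedNesting d m lo hi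
Nested⇒Nesting d empty =
  record { lefts = λ () ; rights = λ () ; isArc = λ () ; lefts-increasing = λ ()
         ; rights-decreasing = λ () ; inner = λ () } , (λ ()) , (λ ())
Nested⇒Nesting {n} d {suc m} {lo} {hi} (around a b ab lo≤a a<b b<hi N) with Nested⇒Nesting d N
... | N′ , a<lefts , rights<b = N″ , lo≤lefts , rights<hi
  where
  L R : Fin (suc m) → Fin n
  L F.zero    = a
  L (F.suc t) = lefts N′ t
  R F.zero    = b
  R (F.suc t) = rights N′ t
  L-increasing : ∀ t u → t <ᶠ u → L t <ᶠ L u
  L-increasing F.zero    (F.suc u) _         = a<lefts u
  L-increasing (F.suc t) (F.suc u) (s≤s t<u) = lefts-increasing N′ t u t<u
  R-decreasing : ∀ t u → t <ᶠ u → R u <ᶠ R t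
  R-decreasing F.zero    (F.suc u) _         = rights<b u
  R-decreasing (F.suc t) (F.suc u) (s≤s t<u) = rights-decreasing N′ t u t<u
  N″ : Nesting d (suc m)
  N″ = record
    { lefts = L ; rights = R
    ; isArc = λ { F.zero → ab ; (F.suc t) → isArc N′ t }
    ; lefts-increasing = L-increasing ; rights-decreasing = R-decreasing
    ; inner = λ { F.zero → a<b ; (F.suc t) → inner N′ t } }
  lo≤lefts : ∀ t → lo ≤ toℕ (L t)
  lo≤lefts F.zero    = lo≤a
  lo≤lefts (F.suc t) = ≤-trans lo≤a (<⇒≤ (a<lefts t))
  rights<hi : ∀ t → toℕ (R t) < hi
  rights<hi F.zero    = b<hi
  rights<hi (F.suc t) = <-trans (rights<b t) b<hi

module Nonnesting (k : ℕ) where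

  NoNesting NoFutureNesting : ∀ {n} → Outs n → Set
  NoNesting       {n} g = depth n g 0 ≤ k
  NoFutureNesting {n} g = ∀ a → g a ≡ semi → depth n g (suc (toℕ a)) < k

  ¬Nesting⇒NoNesting : ∀ {n} (d : OpenPartitionDiagram n) → ¬ Nesting d (suc k) → NoNesting (outs d)
  ¬Nesting⇒NoNesting {n} d ¬N with depth n (outs d) 0 ≤? k
  ... | yes p = p
  ... | no ¬p = ⊥-elim (¬N (proj₁ (Nested⇒Nesting d (depth-complete n _ (suc k) 0 (≰⇒> ¬p)))))

  NoNesting⇒¬Nesting : ∀ {n} (d : OpenPartitionDiagram n) → NoNesting (outs d) → ¬ Nesting d (suc k)
  NoNesting⇒¬Nesting {n} d h N = <⇒≱ (n<1+n k) (≤-trans (depth-sound n _ (Nesting⇒Nested′ d N (λ _ → z≤n))) h)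

  ¬FutureNesting⇒NoFutureNesting : ∀ {n} (d : OpenPartitionDiagram n) →
    ¬ FutureNesting d (suc k) → NoFutureNesting (outs d)
  ¬FutureNesting⇒NoFutureNesting {n} d ¬F a a-semi with depth n (outs d) (suc (toℕ a)) <? k
  ... | yes p = p
  ... | no ¬p with Nested⇒Nesting d (depth-complete n _ k (suc (toℕ a)) (≮⇒≥ ¬p))
  ...   | N , a<lefts , _ = ⊥-elim (¬F (a , a-semi , N , a<lefts))

  NoFutureNesting⇒¬FutureNesting : ∀ {n} (d : OpenPartitionDiagram n) →
    NoFutureNesting (outs d) → ¬ FutureNesting d (suc k)
  NoFutureNesting⇒¬FutureNesting {n} d h (a , a-semi , N , a<lefts) =
    <⇒≱ (h a a-semi) (depth-sound n _ (Nesting⇒Nested′ d N a<lefts))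

ArcsIncreasing RightUnique : ∀ {n} → Outs n → Set
ArcsIncreasing g = ∀ a b → g a ≡ arc b → a <ᶠ b
RightUnique    g = ∀ a a′ b → g a ≡ arc b → g a′ ≡ arc b → a ≡ a′

fromOuts : ∀ {n} (g : Outs n) → .(ArcsIncreasing g) → .(RightUnique g) → OpenPartitionDiagram n
fromOuts g increasing unique = mkOPD (tabulate g)
  (λ a b ab → increasing a b (trans (sym (VP.lookup∘tabulate g a)) ab))
  (λ a a′ b ab a′b → unique a a′ b (trans (sym (VP.lookup∘tabulate g a)) ab)
                                   (trans (sym (VP.lookup∘tabulate g a′)) a′b))

diagram-≡ : ∀ {n} {d d′ : OpenPartitionDiagram n} → (∀ i → outs d i ≡ outs d′ i) → d ≡ d′
diagram-≡ {d = mkOPD v _ _} {mkOPD w _ _} v≗w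
  with trans (sym (VP.tabulate∘lookup v)) (trans (VP.tabulate-cong v≗w) (VP.tabulate∘lookup w))
... | refl = refl

restrict-increasing : ∀ {n} (g : Outs (suc n)) → ArcsIncreasing g → ArcsIncreasing (restrict g)
restrict-increasing g inc a b ab =
  subst₂ _<_ (FP.toℕ-inject₁ a) (FP.toℕ-inject₁ b) (inc _ _ (restrict-arc⁻¹ g a b ab))

restrict-unique : ∀ {n} (g : Outs (suc n)) → RightUnique g → RightUnique (restrict g)
restrict-unique g uniq a a′ b ab a′b =
  FP.inject₁-injective (uniq _ _ _ (restrict-arc⁻¹ g a b ab) (restrict-arc⁻¹ g a′ b a′b))

data ExtensionArc {n} (g : Outs n) (c : Maybe (Fin n)) (i b : Fin (suc n)) : Set where
  old : ∀ a b′ → i ≡ inject₁ a → b ≡ inject₁ b′ → g a ≡ arc b′ → ExtensionArc g c i b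
  new : ∀ a → i ≡ inject₁ a → b ≡ fromℕ n → c ≡ just a → ExtensionArc g c i b

extension-arc : ∀ {n} (g : Outs n) s i b → extend g s i ≡ arc b → ExtensionArc g (Step.closes s) i b
extension-arc g (step o c) i b eq with lastView i
extension-arc g (step true  c) _ b () | last
extension-arc g (step false c) _ b () | last
... | earlier a with g a in ga
extension-arc g (step o c)        _ b refl | earlier a | arc b′ = old a b′ refl refl ga
extension-arc g (step o (just c)) _ b eq   | earlier a | semi with a F.≟ c
extension-arc g (step o (just c)) _ b refl | earlier a | semi | yes refl = new a refl refl refl

extend-increasing : ∀ {n} (g : Outs n) s → ArcsIncreasing g → ArcsIncreasing (extend g s)
extend-increasing {n} g s inc i b ib with extension-arc g s i b ib
... | old a b′ refl refl ab = subst₂ _<_ (sym (FP.toℕ-inject₁ a)) (sym (FP.toℕ-inject₁ b′)) (inc a b′ ab)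
... | new a refl refl _     = subst₂ _<_ (sym (FP.toℕ-inject₁ a)) (sym (FP.toℕ-fromℕ n)) (FP.toℕ<n a)

extend-unique : ∀ {n} (g : Outs n) s → RightUnique g → RightUnique (extend g s)
extend-unique g s uniq i i′ b ib i′b with extension-arc g s i b ib | extension-arc g s i′ b i′b
... | old a b₁ refl refl ab | old a′ b₂ refl b₁≡b₂ a′b =
  cong inject₁ (uniq a a′ b₁ ab (trans a′b (cong arc (sym (FP.inject₁-injective b₁≡b₂)))))
... | old _ _ _ refl _ | new _ _ last≡ _ = ⊥-elim (FP.fromℕ≢inject₁ (sym last≡))
... | new _ _ refl _   | old _ _ _ b≡ _  = ⊥-elim (FP.fromℕ≢inject₁ b≡)
... | new a refl _ c≡a | new a′ refl _ c≡a′ = cong inject₁ (just-injective (trans (sym c≡a) c≡a′))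

isSemi : ∀ {n} → Out n → Bool
isSemi semi = true
isSemi _    = false

isSemi-true : ∀ {n} (o : Out n) → isSemi o ≡ true → o ≡ semi
isSemi-true semi _ = refl

isSemi-opens : ∀ {n} o → isSemi {n} (if o then semi else none) ≡ o
isSemi-opens true  = refl
isSemi-opens false = refl

lastStep : ∀ {n} → Outs (suc n) → Step n
lastStep {n} g = step (isSemi (g (fromℕ n))) (find n (λ a → endsAtLast (g (inject₁ a))))

extend-restrict : ∀ {n} (g : Outs (suc n)) → ArcsIncreasing g → RightUnique g →
  ∀ i → extend (restrict g) (lastStep g) i ≡ g i
extend-restrict {n} g inc uniq i with lastView i
... | last with g (fromℕ n) in eq
...   | none  = refl
...   | semi  = refl
...   | arc b = ⊥-elim (<⇒≱ (subst (_< toℕ b) (FP.toℕ-fromℕ n) (inc _ _ eq)) (≤-pred (FP.toℕ<n b)))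
extend-restrict {n} g inc uniq i | earlier a with g (inject₁ a) in eq
... | none = refl
... | semi with find n (λ a → endsAtLast (g (inject₁ a))) in found
...   | nothing = refl
...   | just c with a F.≟ c
...     | no  _    = refl
...     | yes refl = case trans (sym (cong endsAtLast eq)) (find-just n _ found) of λ ()
extend-restrict {n} g inc uniq i | earlier a | arc b with lastView b
... | earlier _ = refl
... | last rewrite find-characterised n (λ a → endsAtLast (g (inject₁ a))) (just a)
                     (λ a′ ends → cong just (FP.inject₁-injective (uniq _ _ _ eq (endsAtLast-true _ ends))))
                     (λ { a′ refl → trans (cong endsAtLast eq) (endsAtLast-fromℕ n) })
                   with a F.≟ a
...   | yes _   = refl
...   | no  a≢a = ⊥-elim (a≢a refl)

lastStep-extend : ∀ {n} (g : Outs n) s → ClosesSemi g (Step.closes s) →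
  ∀ g′ → (∀ i → g′ i ≡ extend g s i) → lastStep g′ ≡ s
lastStep-extend {n} g s@(step o c) c-semi g′ g′≗ = cong₂ step opens≡ closes≡
  where
  opens≡ : isSemi (g′ (fromℕ n)) ≡ o
  opens≡ rewrite g′≗ (fromℕ n) | extend-fromℕ g s = isSemi-opens o
  ends⇒closes : ∀ a → endsAtLast (g′ (inject₁ a)) ≡ true → c ≡ just a
  ends⇒closes a ends =
    endsAtLast-extendOut c a (g a) (trans (cong endsAtLast (sym (trans (g′≗ _) (extend-inject₁ g s a)))) ends)
  closes⇒ends : ∀ a → c ≡ just a → endsAtLast (g′ (inject₁ a)) ≡ true
  closes⇒ends a refl rewrite g′≗ (inject₁ a) | extend-inject₁ g s a | c-semi = endsAtLast-closing a
  closes≡ : find n (λ a → endsAtLast (g′ (inject₁ a))) ≡ c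
  closes≡ = find-characterised n _ c ends⇒closes closes⇒ends

restrict-closesSemi : ∀ {n} (g : Outs (suc n)) → ClosesSemi (restrict g) (Step.closes (lastStep g))
restrict-closesSemi {n} g with find n (λ a → endsAtLast (g (inject₁ a))) in found
... | nothing = _
... | just c rewrite endsAtLast-true (g (inject₁ c)) (find-just n _ found) | lastView-fromℕ n = refl

restrictD : ∀ {n} → OpenPartitionDiagram (suc n) → OpenPartitionDiagram n
restrictD (mkOPD v inc uniq) =
  fromOuts (restrict (lookup v)) (restrict-increasing (lookup v) inc) (restrict-unique (lookup v) uniq)

extendD : ∀ {n} → OpenPartitionDiagram n → Step n → OpenPartitionDiagram (suc n)
extendD (mkOPD v inc uniq) s =
  fromOuts (extend (lookup v) s) (extend-increasing (lookup v) s inc) (extend-unique (lookup v) s uniq)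

outs-restrictD : ∀ {n} (D : OpenPartitionDiagram (suc n)) i → outs (restrictD D) i ≡ restrict (outs D) i
outs-restrictD (mkOPD v _ _) = VP.lookup∘tabulate (restrict (lookup v))

outs-extendD : ∀ {n} (d : OpenPartitionDiagram n) s i → outs (extendD d s) i ≡ extend (outs d) s i
outs-extendD (mkOPD v _ _) s = VP.lookup∘tabulate (extend (lookup v) s)

restrictD-extendD : ∀ {n} (d : OpenPartitionDiagram n) s → restrictD (extendD d s) ≡ d
restrictD-extendD d s = diagram-≡ λ a →
  trans (outs-restrictD (extendD d s) a)
        (trans (cong restrictOut (outs-extendD d s (inject₁ a))) (restrict-extend (outs d) s a))

-- The pointwise equation only holds for well-formed diagrams, whose proofs are irrelevant;
-- decidability of equality recovers it.
extendD-restrictD : ∀ {n} (D : OpenPartitionDiagram (suc n)) → extendD (restrictD D) (lastStep (outs D)) ≡ D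
extendD-restrictD D@(mkOPD v inc uniq) = diagram-≡ λ i →
  trans (outs-extendD (restrictD D) _ i)
        (trans (extend-cong (outs-restrictD D) i)
               (recompute (_ ≟ₒ _) (extend-restrict (lookup v) inc uniq i)))
  where
  extend-cong : ∀ {n} {g h : Outs n} {s} → (∀ a → g a ≡ h a) → ∀ i → extend g s i ≡ extend h s i
  extend-cong {s = step o c} g≗h i with lastView i
  ... | last      = refl
  ... | earlier a = cong (extendOut c a) (g≗h a)

restrictOut-semi : ∀ {n} (o : Out (suc n)) → restrictOut o ≡ semi → o ≡ semi ⊎ o ≡ arc (fromℕ n)
restrictOut-semi semi    _ = inj₁ refl
restrictOut-semi (arc b) eq with lastView b
restrictOut-semi (arc _) eq | last      = inj₂ refl
restrictOut-semi (arc _) () | earlier _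

module Growth (k : ℕ) where

  IsNonnesting : ∀ {n} → OpenPartitionDiagram n → Set
  IsNonnesting d = ¬ Nesting d (suc k) × ¬ FutureNesting d (suc k)

  restrictD-nonnesting : ∀ {n} (D : OpenPartitionDiagram (suc n)) → IsNonnesting D → IsNonnesting (restrictD D)
  restrictD-nonnesting {n} D (¬N , ¬F) = ¬N′ , ¬F′
    where
    g = outs D
    inRestriction : ∀ {m lo} (N : Nesting (restrictD D) m) → (∀ t → lo ≤ toℕ (lefts N t)) →
      Nested (restrict g) m lo n
    inRestriction N lo≤ = Nested-cong (outs-restrictD D) (Nesting⇒Nested′ (restrictD D) N lo≤)
    ¬N′ : ¬ Nesting (restrictD D) (suc k)
    ¬N′ N = ¬N (proj₁ (Nested⇒Nesting D (Nested-unrestrict g (inRestriction N (λ _ → z≤n)))))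
    ¬F′ : ¬ FutureNesting (restrictD D) (suc k)
    ¬F′ (a , a-semi , N , a<lefts) with restrictOut-semi (g (inject₁ a)) (trans (sym (outs-restrictD D a)) a-semi)
    ... | inj₁ semi-in-D = ¬F (inject₁ a , semi-in-D , proj₁ N′ , proj₁ (proj₂ N′))
      where
      N′ = Nested⇒Nesting D (subst (λ x → Nested g k (suc x) n) (sym (FP.toℕ-inject₁ a))
                               (Nested-unrestrict g (inRestriction N a<lefts)))
    ... | inj₂ ends-at-last =
      ¬N (proj₁ (Nested⇒Nesting D (Nested-aroundLast g a ends-at-last z≤n (inRestriction N a<lefts))))

  record Admissible {n} (d : OpenPartitionDiagram n) (s : Step n) : Set where
    constructor admissible
    field
      .closes-semi       : ClosesSemi (outs d) (Step.closes s)
      .no-nesting        : ¬ Nesting (extendD d s) (suc k)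
      .no-future-nesting : ¬ FutureNesting (extendD d s) (suc k)

  Extension : ∀ {n} → NonnestingDiagram k n → Set
  Extension {n} d = Σ (Step n) (Admissible (diagram d))

  restrictNN : ∀ {n} → NonnestingDiagram k (suc n) → Σ (NonnestingDiagram k n) Extension
  restrictNN (mkΠ D ¬N ¬F) =
    mkΠ (restrictD D) (proj₁ (restrictD-nonnesting D (¬N , ¬F))) (proj₂ (restrictD-nonnesting D (¬N , ¬F))) ,
    lastStep (outs D) ,
    admissible closesSemi (subst (λ x → ¬ Nesting x (suc k)) (sym D≡) ¬N)
                          (subst (λ x → ¬ FutureNesting x (suc k)) (sym D≡) ¬F)
    where
    D≡ = extendD-restrictD D
    closesSemi : ClosesSemi (outs (restrictD D)) (Step.closes (lastStep (outs D)))
    closesSemi with Step.closes (lastStep (outs D)) | restrict-closesSemi (outs D)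
    ... | nothing | _ = _
    ... | just c  | c-semi = trans (outs-restrictD D c) c-semi

  extendNN : ∀ {n} → Σ (NonnestingDiagram k n) Extension → NonnestingDiagram k (suc n)
  extendNN (d , s , admissible _ ¬N ¬F) = mkΠ (extendD (diagram d) s) ¬N ¬F

  NonnestingDiagram-≡ : ∀ {n} {x y : NonnestingDiagram k n} → diagram x ≡ diagram y → x ≡ y
  NonnestingDiagram-≡ {x = mkΠ _ _ _} {mkΠ _ _ _} refl = refl

  Extension-≡ : ∀ {n} {x y : Σ (NonnestingDiagram k n) Extension} →
    diagram (proj₁ x) ≡ diagram (proj₁ y) → proj₁ (proj₂ x) ≡ proj₁ (proj₂ y) → x ≡ y
  Extension-≡ {x = mkΠ _ _ _ , _ , admissible _ _ _} {mkΠ _ _ _ , _ , admissible _ _ _} refl refl = refl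

  growth : ∀ {n} → NonnestingDiagram k (suc n) ↔ Σ (NonnestingDiagram k n) Extension
  growth = mk↔ₛ′ restrictNN extendNN restrict∘extend extend∘restrict
    where
    restrict∘extend : ∀ x → restrictNN (extendNN x) ≡ x
    restrict∘extend (mkΠ d _ _ , s , admissible c-semi _ _) = Extension-≡ (restrictD-extendD d s)
      (lastStep-extend (outs d) s (recompute (closesSemi? (outs d) (Step.closes s)) c-semi)
                       (outs (extendD d s)) (outs-extendD d s))
    extend∘restrict : ∀ D → extendNN (restrictNN D) ≡ D
    extend∘restrict (mkΠ D _ _) = NonnestingDiagram-≡ (extendD-restrictD D)

-- Nesting indices and labels
nestingIndex : ∀ {n} → Outs n → Fin n → ℕ
nestingIndex {n} g a = depth n g (suc (toℕ a))

semisFrom : ∀ {n} → Outs n → ℕ → ℕ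
semisFrom {n} g m = count n (λ b → isSemi (g b) ∧ (m ≤ᵇ nestingIndex g b))

semiRank : ∀ {n} → Outs n → Fin n → ℕ
semiRank {n} g = rank n (isSemi ∘ g)

nestingIndex-antitone : ∀ {n} (g : Outs n) a b → toℕ b ≤ toℕ a → nestingIndex g a ≤ nestingIndex g b
nestingIndex-antitone {n} g a b b≤a = depth-antitone n g (s≤s b≤a)

semisFrom-cong : ∀ {n} {g h : Outs n} → (∀ i → g i ≡ h i) → ∀ m → semisFrom g m ≡ semisFrom h m
semisFrom-cong {n} g≗h m = ∑-cong n λ b →
  cong₂ (λ o x → 𝟙 (isSemi o ∧ (m ≤ᵇ x))) (g≗h b) (depth-cong n g≗h _)

extendedTerm : ∀ {n} → Outs n → Maybe (Fin n) → ℕ → Fin n → ℕ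
extendedTerm g c m b = 𝟙 (isSemi (extendOut c b (g b)) ∧ (m ≤ᵇ (nestingIndex g b ⊔ closing g c (suc (toℕ b)))))

semisFrom-extend : ∀ {n} (g : Outs n) s → ClosesSemi g (Step.closes s) → ∀ m →
  semisFrom (extend g s) m ≡ ∑ n (extendedTerm g (Step.closes s) m) + 𝟙 (Step.opens s ∧ (m ≤ᵇ 0))
semisFrom-extend {n} g s c-semi m = cong₂ _+_ (∑-cong n oldTerm) newTerm
  where
  oldTerm : ∀ b → 𝟙 (isSemi (extend g s (inject₁ b)) ∧ (m ≤ᵇ nestingIndex (extend g s) (inject₁ b)))
            ≡ extendedTerm g (Step.closes s) m b
  oldTerm b rewrite extend-inject₁ g s b | FP.toℕ-inject₁ b | depth-extend n g s c-semi (suc (toℕ b)) = refl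
  newTerm : 𝟙 (isSemi (extend g s (fromℕ n)) ∧ (m ≤ᵇ nestingIndex (extend g s) (fromℕ n)))
          ≡ 𝟙 (Step.opens s ∧ (m ≤ᵇ 0))
  newTerm rewrite extend-fromℕ g s | isSemi-opens {suc n} (Step.opens s)
            | depth-beyond (suc n) (extend g s) (suc (toℕ (fromℕ n)))
                           (s≤s (≤-reflexive (sym (FP.toℕ-fromℕ n)))) = refl

isSemi-extendOut-nothing : ∀ {n} (b : Fin n) o → isSemi (extendOut nothing b o) ≡ isSemi o
isSemi-extendOut-nothing b none    = refl
isSemi-extendOut-nothing b semi    = refl
isSemi-extendOut-nothing b (arc _) = refl

isSemi-extendOut-closed : ∀ {n} (a : Fin n) o → isSemi (extendOut (just a) a o) ≡ false
isSemi-extendOut-closed a none    = refl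
isSemi-extendOut-closed a (arc _) = refl
isSemi-extendOut-closed a semi with a F.≟ a
... | yes _   = refl
... | no  a≢a = ⊥-elim (a≢a refl)

isSemi-extendOut-other : ∀ {n} {a b : Fin n} o → b ≢ a → isSemi (extendOut (just a) b o) ≡ isSemi o
isSemi-extendOut-other none    _ = refl
isSemi-extendOut-other (arc _) _ = refl
isSemi-extendOut-other {a = a} {b} semi b≢a with b F.≟ a
... | yes b≡a = ⊥-elim (b≢a b≡a)
... | no  _   = refl

closing-left : ∀ {n} (g : Outs n) a (b : Fin n) → toℕ b < toℕ a →
  closing g (just a) (suc (toℕ b)) ≡ suc (nestingIndex g a)
closing-left g a b b<a rewrite ≤⇒≤ᵇ≡true b<a = refl

closing-right : ∀ {n} (g : Outs n) a (b : Fin n) → toℕ a ≤ toℕ b → closing g (just a) (suc (toℕ b)) ≡ 0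
closing-right g a b a≤b rewrite >⇒≤ᵇ≡false (s≤s a≤b) = refl

index⊔closing-right : ∀ {n} (g : Outs n) a (b : Fin n) → toℕ a ≤ toℕ b →
  nestingIndex g b ⊔ closing g (just a) (suc (toℕ b)) ≡ nestingIndex g b
index⊔closing-right g a b a≤b = trans (cong (nestingIndex g b ⊔_) (closing-right g a b a≤b)) (⊔-identityʳ _)

-- Closing the semi-arc at a removes it and raises the nesting index of every semi-arc
-- to its left to at least nestingIndex g a + 1; the three cases below compare m with that value.
extendedTerm-nothing : ∀ {n} (g : Outs n) m b →
  extendedTerm g nothing m b ≡ 𝟙 (isSemi (g b) ∧ (m ≤ᵇ nestingIndex g b))
extendedTerm-nothing g m b rewrite isSemi-extendOut-nothing b (g b) | ⊔-identityʳ (nestingIndex g b) = refl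

extendedTerm-below : ∀ {n} (g : Outs n) a → g a ≡ semi → ∀ m → m ≤ nestingIndex g a → ∀ b →
  extendedTerm g (just a) m b + pointMass a b ≡ 𝟙 (isSemi (g b) ∧ (m ≤ᵇ nestingIndex g b))
extendedTerm-below g a a-semi m m≤x b with b F.≟ a
... | yes refl rewrite isSemi-extendOut-closed b (g b) | a-semi | ≤⇒≤ᵇ≡true m≤x = refl
... | no b≢a rewrite isSemi-extendOut-other (g b) b≢a = trans (+-identityʳ _) (cong (λ x → 𝟙 (isSemi (g b) ∧ x)) same)
  where
  same : (m ≤ᵇ (nestingIndex g b ⊔ closing g (just a) (suc (toℕ b)))) ≡ (m ≤ᵇ nestingIndex g b)
  same with toℕ b <? toℕ a
  ... | yes b<a = trans (≤⇒≤ᵇ≡true (≤-trans m≤b (m≤m⊔n _ _))) (sym (≤⇒≤ᵇ≡true m≤b))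
    where m≤b = ≤-trans m≤x (nestingIndex-antitone g a b (<⇒≤ b<a))
  ... | no b≮a = cong (m ≤ᵇ_) (index⊔closing-right g a b (≮⇒≥ b≮a))

extendedTerm-at : ∀ {n} (g : Outs n) a → g a ≡ semi → ∀ b →
  extendedTerm g (just a) (suc (nestingIndex g a)) b ≡ 𝟙 (isSemi (g b) ∧ (suc (toℕ b) ≤ᵇ toℕ a))
extendedTerm-at g a a-semi b with b F.≟ a
... | yes refl rewrite isSemi-extendOut-closed b (g b) | a-semi | >⇒≤ᵇ≡false (n<1+n (toℕ b)) = refl
... | no b≢a rewrite isSemi-extendOut-other (g b) b≢a = cong (λ x → 𝟙 (isSemi (g b) ∧ x)) same
  where
  x = nestingIndex g a
  same : (suc x ≤ᵇ (nestingIndex g b ⊔ closing g (just a) (suc (toℕ b)))) ≡ (suc (toℕ b) ≤ᵇ toℕ a)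
  same with toℕ b <? toℕ a
  ... | yes b<a = trans (≤⇒≤ᵇ≡true (≤-trans (≤-reflexive (sym (closing-left g a b b<a))) (m≤n⊔m (nestingIndex g b) _)))
                        (sym (≤⇒≤ᵇ≡true b<a))
  ... | no b≮a = trans (>⇒≤ᵇ≡false (subst (_< suc x) (sym (index⊔closing-right g a b (≮⇒≥ b≮a)))
                                        (s≤s (nestingIndex-antitone g b a (≮⇒≥ b≮a)))))
                       (sym (>⇒≤ᵇ≡false (s≤s (≮⇒≥ b≮a))))

extendedTerm-above : ∀ {n} (g : Outs n) a → g a ≡ semi → ∀ m → suc (nestingIndex g a) < m → ∀ b →
  extendedTerm g (just a) m b ≡ 𝟙 (isSemi (g b) ∧ (m ≤ᵇ nestingIndex g b))
extendedTerm-above g a a-semi m x<m b with b F.≟ a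
... | yes refl rewrite isSemi-extendOut-closed b (g b) | a-semi | >⇒≤ᵇ≡false (<-trans (n<1+n _) x<m) = refl
... | no b≢a rewrite isSemi-extendOut-other (g b) b≢a = cong (λ x → 𝟙 (isSemi (g b) ∧ x)) same
  where
  same : (m ≤ᵇ (nestingIndex g b ⊔ closing g (just a) (suc (toℕ b)))) ≡ (m ≤ᵇ nestingIndex g b)
  same with m ≤? nestingIndex g b
  ... | yes m≤b = trans (≤⇒≤ᵇ≡true (≤-trans m≤b (m≤m⊔n _ _))) (sym (≤⇒≤ᵇ≡true m≤b))
  ... | no m≰b = trans (>⇒≤ᵇ≡false (⊔-pres-<m (≰⇒> m≰b) (≤-<-trans (guard-≤ _ _) x<m)))
                       (sym (>⇒≤ᵇ≡false (≰⇒> m≰b)))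

semisFrom-open : ∀ {n} (g : Outs n) o m →
  semisFrom (extend g (step o nothing)) m ≡ semisFrom g m + 𝟙 (o ∧ (m ≤ᵇ 0))
semisFrom-open {n} g o m =
  trans (semisFrom-extend g (step o nothing) _ m) (cong (_+ _) (∑-cong n (extendedTerm-nothing g m)))

semisFrom-close-below : ∀ {n} (g : Outs n) a → g a ≡ semi → ∀ o m → m ≤ nestingIndex g a →
  semisFrom (extend g (step o (just a))) m + 1 ≡ semisFrom g m + 𝟙 (o ∧ (m ≤ᵇ 0))
semisFrom-close-below {n} g a a-semi o m m≤x = begin
  semisFrom (extend g (step o (just a))) m + 1
    ≡⟨ cong (_+ 1) (semisFrom-extend g (step o (just a)) a-semi m) ⟩
  ∑ n term + I + 1
    ≡⟨ +-assoc (∑ n term) I 1 ⟩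
  ∑ n term + (I + 1)
    ≡⟨ cong (∑ n term +_) (+-comm I 1) ⟩
  ∑ n term + (1 + I)
    ≡⟨ +-assoc (∑ n term) 1 I ⟨
  ∑ n term + 1 + I
    ≡⟨ cong (λ x → ∑ n term + x + I) (∑-pointMass n a) ⟨
  ∑ n term + ∑ n (pointMass a) + I
    ≡⟨ cong (_+ I) (∑-+ n term (pointMass a)) ⟨
  ∑ n (λ b → term b + pointMass a b) + I
    ≡⟨ cong (_+ I) (∑-cong n (extendedTerm-below g a a-semi m m≤x)) ⟩
  semisFrom g m + I ∎
  where
  open ≡-Reasoning
  term = extendedTerm g (just a) m
  I = 𝟙 (o ∧ (m ≤ᵇ 0))

semisFrom-close-at : ∀ {n} (g : Outs n) a → g a ≡ semi → ∀ o →
  semisFrom (extend g (step o (just a))) (suc (nestingIndex g a)) ≡ semiRank g a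
semisFrom-close-at {n} g a a-semi o = trans (semisFrom-extend g (step o (just a)) a-semi _)
  (trans (cong₂ _+_ (∑-cong n (extendedTerm-at g a a-semi)) (cong 𝟙 (∧-zeroʳ o))) (+-identityʳ _))

semisFrom-close-above : ∀ {n} (g : Outs n) a → g a ≡ semi → ∀ o m → suc (nestingIndex g a) < m →
  semisFrom (extend g (step o (just a))) m ≡ semisFrom g m
semisFrom-close-above {n} g a a-semi o (suc m) x<m = trans (semisFrom-extend g (step o (just a)) a-semi (suc m))
  (trans (cong₂ _+_ (∑-cong n (extendedTerm-above g a a-semi (suc m) x<m)) (cong 𝟙 (∧-zeroʳ o))) (+-identityʳ _))

-- Nesting indices decrease from left to right, so the semi-arcs of index ≥ m are
-- exactly the first semisFrom g m semi-arcs.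
semiRank<semisFrom : ∀ {n} (g : Outs n) {a} → g a ≡ semi → ∀ {m} → m ≤ nestingIndex g a →
  semiRank g a < semisFrom g m
semiRank<semisFrom {n} g {a} a-semi {m} m≤x = ∑-<-mono n a pointwise
  where
  pointwise : ∀ b → 𝟙 (isSemi (g b) ∧ (suc (toℕ b) ≤ᵇ toℕ a)) + pointMass a b
                  ≤ 𝟙 (isSemi (g b) ∧ (m ≤ᵇ nestingIndex g b))
  pointwise b with b F.≟ a
  ... | yes refl rewrite a-semi | >⇒≤ᵇ≡false (n<1+n (toℕ b)) | ≤⇒≤ᵇ≡true m≤x = ≤-refl
  ... | no _ rewrite +-identityʳ (𝟙 (isSemi (g b) ∧ (suc (toℕ b) ≤ᵇ toℕ a)))
    with isSemi (g b) | suc (toℕ b) ≤ᵇ toℕ a in b<a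
  ...   | false | _     = z≤n
  ...   | true  | false = z≤n
  ...   | true  | true
    rewrite ≤⇒≤ᵇ≡true (≤-trans m≤x (nestingIndex-antitone g a b (<⇒≤ (≤ᵇ≡true⇒≤ _ _ b<a)))) = ≤-refl

semisFrom≤semiRank : ∀ {n} (g : Outs n) {a} → g a ≡ semi → ∀ {m} → nestingIndex g a < m →
  semisFrom g m ≤ semiRank g a
semisFrom≤semiRank {n} g {a} a-semi {m} x<m = ∑-mono n pointwise
  where
  pointwise : ∀ b → 𝟙 (isSemi (g b) ∧ (m ≤ᵇ nestingIndex g b))
                  ≤ 𝟙 (isSemi (g b) ∧ (suc (toℕ b) ≤ᵇ toℕ a))
  pointwise b with isSemi (g b) | m ≤ᵇ nestingIndex g b in m≤b
  ... | false | _     = z≤n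
  ... | true  | false = z≤n
  ... | true  | true with toℕ b <? toℕ a
  ...   | yes b<a rewrite ≤⇒≤ᵇ≡true b<a = ≤-refl
  ...   | no b≮a  = ⊥-elim (<⇒≱ x<m (≤-trans (≤ᵇ≡true⇒≤ _ _ m≤b) (nestingIndex-antitone g b a (≮⇒≥ b≮a))))

semisFrom≤count : ∀ {n} (g : Outs n) m → semisFrom g m ≤ count n (isSemi ∘ g)
semisFrom≤count {n} g m = ∑-mono n pointwise
  where
  pointwise : ∀ b → 𝟙 (isSemi (g b) ∧ (m ≤ᵇ nestingIndex g b)) ≤ 𝟙 (isSemi (g b))
  pointwise b with isSemi (g b)
  ... | false = z≤n
  ... | true  = 𝟙≤1 _

nestingIndex-by-rank : ∀ {n} (g : Outs n) {a} → g a ≡ semi → ∀ {j} →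
  semisFrom g (suc j) ≤ semiRank g a → semiRank g a < semisFrom g j → nestingIndex g a ≡ j
nestingIndex-by-rank g {a} a-semi {j} lower upper with <-cmp (nestingIndex g a) j
... | tri< x<j _ _ = ⊥-elim (<⇒≱ upper (semisFrom≤semiRank g a-semi x<j))
... | tri≈ _ x≡j _ = x≡j
... | tri> _ _ j<x = ⊥-elim (<⇒≱ (semiRank<semisFrom g a-semi j<x) lower)

module Labels (k : ℕ) where

  label : ∀ {n} → Outs n → Vec ℕ k
  label g = tabulate (semisFrom g ∘ toℕ)

  label-cong : ∀ {n} {g h : Outs n} → (∀ i → g i ≡ h i) → label g ≡ label h
  label-cong g≗h = VP.tabulate-cong (semisFrom-cong g≗h ∘ toℕ)

  module _ {n : ℕ} (g : Outs n) where

    label-at : ∀ m → m < k → label g at m ≡ semisFrom g m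
    label-at = at-tabulate k (semisFrom g)

    label-open-none : label (extend g (step false nothing)) ≡ label g
    label-open-none = VP.tabulate-cong λ m → trans (semisFrom-open g false (toℕ m)) (+-identityʳ _)

    label-open-semi : label (extend g (step true nothing)) ≡ inc0 (label g)
    label-open-semi = VP.tabulate-cong λ m → entry (toℕ m) (FP.toℕ<n m)
      where
      entry : ∀ m → m < k → semisFrom (extend g (step true nothing)) m
                             ≡ (if m ≡ᵇ 0 then suc (label g at 0) else label g at m)
      entry zero    0<k rewrite label-at 0 0<k = trans (semisFrom-open g true 0) (+-comm _ 1)
      entry (suc m) m<k rewrite label-at (suc m) m<k = trans (semisFrom-open g true (suc m)) (+-identityʳ _)

    module _ (a : Fin n) (a-semi : g a ≡ semi) (o : Bool) where

      private
        x = nestingIndex g a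
        g′ = extend g (step o (just a))

        at-0 : 0 < k → semisFrom g′ 0 ≡ (label g at 0) ∸ 𝟙 (not o)
        at-0 0<k rewrite label-at 0 0<k = +1≡+𝟙⇒≡∸𝟙not _ _ o
          (trans (semisFrom-close-below g a a-semi o 0 z≤n) (cong (λ b → semisFrom g 0 + 𝟙 b) (∧-identityʳ o)))

        at-below : ∀ m → m < x → suc m < k → semisFrom g′ (suc m) ≡ (label g at suc m) ∸ 1
        at-below m m<x m<k rewrite label-at (suc m) m<k = +1≡+𝟙⇒≡∸𝟙not _ _ false
          (trans (semisFrom-close-below g a a-semi o (suc m) m<x) (cong (λ b → semisFrom g (suc m) + 𝟙 b) (∧-zeroʳ o)))

      label-close-shallow : suc x < k → label g′ ≡ modLabel (label g) (𝟙 (not o)) (suc x) (semiRank g a)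
      label-close-shallow x<k = VP.tabulate-cong λ m → entry (toℕ m) (FP.toℕ<n m)
        where
        entry : ∀ m → m < k → semisFrom g′ m ≡
                  (if m ≡ᵇ 0 then (label g at 0) ∸ 𝟙 (not o)
                   else if m <ᵇ suc x then (label g at m) ∸ 1
                   else if m ≡ᵇ suc x then semiRank g a else label g at m)
        entry zero 0<k = at-0 0<k
        entry (suc m) m<k with <-cmp m x
        ... | tri< m<x _ _ rewrite <⇒<ᵇ≡true m<x = at-below m m<x m<k
        ... | tri≈ _ refl _ rewrite ≥⇒<ᵇ≡false (≤-refl {m}) | ≡ᵇ-refl m = semisFrom-close-at g a a-semi o
        ... | tri> _ m≢x x<m rewrite ≥⇒<ᵇ≡false (<⇒≤ x<m) | ≢⇒≡ᵇ≡false m≢x | label-at (suc m) m<k =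
          semisFrom-close-above g a a-semi o (suc m) (s≤s x<m)

      label-close-deep : k ≤ suc x → label g′ ≡ lastLabel (label g) (𝟙 (not o))
      label-close-deep k≤x = VP.tabulate-cong λ m → entry (toℕ m) (FP.toℕ<n m)
        where
        entry : ∀ m → m < k →
          semisFrom g′ m ≡ (if m ≡ᵇ 0 then (label g at 0) ∸ 𝟙 (not o) else (label g at m) ∸ 1)
        entry zero    0<k = at-0 0<k
        entry (suc m) m<k = at-below m (≤-pred (≤-trans m<k k≤x)) m<k

-- Admissible extensions and the succession rule
module Admissibility (k : ℕ) (k≥1 : 1 ≤ k) {n : ℕ} (D : OpenPartitionDiagram n) where
  open Nonnesting k
  open Growth k

  private
    g = outs D

  Shallow Deep : Fin n → Set
  Shallow a = g a ≡ semi × suc (nestingIndex g a) < k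
  Deep    a = g a ≡ semi × k ≤ suc (nestingIndex g a) × semiRank g a ≡ 0

  -- Closing a semi-arc a is only forbidden when it creates a (k+1)-nesting ending at the new vertex
  -- or, through a semi-arc to the left of a, a future (k+1)-nesting.
  Closable : Maybe (Fin n) → Set
  Closable c = ∀ a → c ≡ just a → suc (nestingIndex g a) < k ⊎ semiRank g a ≡ 0

  module _ (no-nesting : NoNesting g) (no-future : NoFutureNesting g) where

    closing≤k : ∀ c → ClosesSemi g c → ∀ lo → closing g c lo ≤ k
    closing≤k nothing  _      lo = z≤n
    closing≤k (just a) a-semi lo = ≤-trans (guard-≤ _ _) (no-future a a-semi)

    closing<k : ∀ c → Closable c → ∀ b → g b ≡ semi → closing g c (suc (toℕ b)) < k
    closing<k nothing  _        b _      = k≥1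
    closing<k (just a) closable b b-semi with toℕ b <? toℕ a
    ... | no b≮a rewrite closing-right g a b (≮⇒≥ b≮a) = k≥1
    ... | yes b<a rewrite closing-left g a b b<a with closable a refl
    ...   | inj₁ x<k = x<k
    ...   | inj₂ rank≡0 =
      ⊥-elim (<-irrefl (sym rank≡0) (≤-<-trans z≤n (rank-<-mono n (isSemi ∘ g) (cong isSemi b-semi) b<a)))

    closable⇒admissible : ∀ o c → ClosesSemi g c → Closable c → Admissible D (step o c)
    closable⇒admissible o c c-semi closable = record
      { closes-semi       = c-semi
      ; no-nesting        = NoNesting⇒¬Nesting (extendD D (step o c)) no-nesting′
      ; no-future-nesting = NoFutureNesting⇒¬FutureNesting (extendD D (step o c)) no-future′
      }
      where
      g′ = extend g (step o c)
      depth≡ : ∀ lo → depth (suc n) (outs (extendD D (step o c))) lo ≡ depth n g lo ⊔ closing g c lo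
      depth≡ lo = trans (depth-cong (suc n) (outs-extendD D (step o c)) lo) (depth-extend n g (step o c) c-semi lo)
      no-nesting′ : NoNesting (outs (extendD D (step o c)))
      no-nesting′ = subst (_≤ k) (sym (depth≡ 0)) (⊔-lub no-nesting (closing≤k c c-semi 0))
      no-future″ : NoFutureNesting g′
      no-future″ i i-semi with lastView i
      ... | last = subst (_< k) (sym (depth-beyond (suc n) g′ _ (s≤s (≤-reflexive (sym (FP.toℕ-fromℕ n)))))) k≥1
      ... | earlier b rewrite FP.toℕ-inject₁ b | depth-extend n g (step o c) c-semi (suc (toℕ b)) =
        ⊔-pres-<m (no-future b b-semi) (closing<k c closable b b-semi)
        where
        b-semi : g b ≡ semi
        b-semi = extendOut-semi c b (g b) i-semi
      no-future′ : NoFutureNesting (outs (extendD D (step o c)))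
      no-future′ i i-semi = subst (_< k) (sym (depth-cong (suc n) (outs-extendD D (step o c)) _))
        (no-future″ i (trans (sym (outs-extendD D (step o c) i)) i-semi))

  admissible⇒semi : ∀ {o a} → Admissible D (step o (just a)) → g a ≡ semi
  admissible⇒semi (admissible c-semi _ _) = recompute (g _ ≟ₒ semi) c-semi

  admissible⇒leftmost : ∀ {o a} → Admissible D (step o (just a)) → k ≤ suc (nestingIndex g a) → semiRank g a ≡ 0
  admissible⇒leftmost {o} {a} adm@(admissible _ _ ¬F) k≤x =
    recompute (semiRank g a ≟ 0) (leftmost (¬FutureNesting⇒NoFutureNesting (extendD D (step o (just a))) ¬F))
    where
    a-semi = admissible⇒semi adm
    leftmost : NoFutureNesting (outs (extendD D (step o (just a)))) → semiRank g a ≡ 0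
    leftmost no-future with semiRank g a in rank≡
    ... | zero  = refl
    ... | suc _ with ∑-positive n _ (subst (0 <_) (sym rank≡) (s≤s z≤n))
    ...   | b , positive with 𝟙-positive (isSemi (g b)) _ positive
    ...     | b-semi , b<a = ⊥-elim (<⇒≱ (no-future (inject₁ b) b-semi′) (≤-trans k≤x raised))
      where
      b<a′ = ≤ᵇ≡true⇒≤ _ _ b<a
      b-semi′ : outs (extendD D (step o (just a))) (inject₁ b) ≡ semi
      b-semi′ = trans (outs-extendD D _ (inject₁ b))
        (trans (extend-inject₁ g (step o (just a)) b)
          (trans (cong (extendOut (just a) b) (isSemi-true _ b-semi))
                 (extendOut-semi-other (λ { refl → <-irrefl refl b<a′ }))))
      raised : suc (nestingIndex g a) ≤ depth (suc n) (outs (extendD D (step o (just a)))) (suc (toℕ (inject₁ b)))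
      raised rewrite depth-cong (suc n) (outs-extendD D (step o (just a))) (suc (toℕ (inject₁ b)))
                   | FP.toℕ-inject₁ b | depth-extend n g (step o (just a)) a-semi (suc (toℕ b))
                   | closing-left g a b b<a′ = m≤n⊔m _ _

  module _ (no-nesting : NoNesting g) (no-future : NoFutureNesting g) where

    admissible↔ : ∀ o a → Admissible D (step o (just a)) ↔ (Shallow a ⊎ Deep a)
    admissible↔ o a = mk↔ₛ′ classify declassify classify∘declassify (λ _ → refl)
      where
      classify : Admissible D (step o (just a)) → Shallow a ⊎ Deep a
      classify adm with suc (nestingIndex g a) <? k
      ... | yes x<k = inj₁ (admissible⇒semi adm , x<k)
      ... | no  x≮k = inj₂ (admissible⇒semi adm , ≮⇒≥ x≮k , admissible⇒leftmost adm (≮⇒≥ x≮k))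
      declassify : Shallow a ⊎ Deep a → Admissible D (step o (just a))
      declassify (inj₁ (a-semi , x<k)) =
        closable⇒admissible no-nesting no-future o (just a) a-semi λ { _ refl → inj₁ x<k }
      declassify (inj₂ (a-semi , _ , r≡0)) =
        closable⇒admissible no-nesting no-future o (just a) a-semi λ { _ refl → inj₂ r≡0 }
      classify∘declassify : ∀ x → classify (declassify x) ≡ x
      classify∘declassify (inj₁ (a-semi , x<k)) with suc (nestingIndex g a) <? k
      ... | yes x<k′ = cong inj₁ (cong₂ _,_ (uip _ _) (≤-irrelevant _ _))
      ... | no  x≮k  = ⊥-elim (x≮k x<k)
      classify∘declassify (inj₂ (a-semi , k≤x , r≡0)) with suc (nestingIndex g a) <? k
      ... | yes x<k = ⊥-elim (<⇒≱ x<k k≤x)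
      ... | no  _   = cong inj₂ (cong₂ _,_ (uip _ _) (cong₂ _,_ (≤-irrelevant _ _) (uip _ _)))

    admissible-nothing : ∀ o → Admissible D (step o nothing)
    admissible-nothing o = closable⇒admissible no-nesting no-future o nothing _ λ _ ()

Σ-Step↔ : ∀ {n} {P : Step n → Set} →
  Σ (Step n) P ↔ (P (step false nothing) ⊎ P (step true nothing) ⊎
                  (Σ (Fin n) (P ∘ step true ∘ just) ⊎ Σ (Fin n) (P ∘ step false ∘ just)))
Σ-Step↔ = mk↔ₛ′
  (λ { (step false nothing , p) → inj₁ p ; (step true nothing , p) → inj₂ (inj₁ p)
     ; (step true (just a) , p) → inj₂ (inj₂ (inj₁ (a , p)))
     ; (step false (just a) , p) → inj₂ (inj₂ (inj₂ (a , p))) })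
  (λ { (inj₁ p) → _ , p ; (inj₂ (inj₁ p)) → _ , p
     ; (inj₂ (inj₂ (inj₁ (a , p)))) → _ , p ; (inj₂ (inj₂ (inj₂ (a , p)))) → _ , p })
  (λ { (inj₁ _) → refl ; (inj₂ (inj₁ _)) → refl
     ; (inj₂ (inj₂ (inj₁ _))) → refl ; (inj₂ (inj₂ (inj₂ _))) → refl })
  (λ { (step false nothing , p) → refl ; (step true nothing , p) → refl
     ; (step true (just a) , p) → refl ; (step false (just a) , p) → refl })

module Children (k : ℕ) (k≥1 : 1 ≤ k) {n : ℕ} (D : OpenPartitionDiagram n) where
  open Nonnesting k
  open Growth k
  open Labels k
  open Admissibility k k≥1 D

  private
    g = outs D
    s = label g

  s-at-suc≤rank : ∀ {a} → g a ≡ semi → suc (nestingIndex g a) < k → s at suc (nestingIndex g a) ≤ semiRank g a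
  s-at-suc≤rank {a} a-semi x<k =
    subst (_≤ semiRank g a) (sym (label-at g _ x<k)) (semisFrom≤semiRank g a-semi (n<1+n _))

  rank<s-at : ∀ {a} → g a ≡ semi → suc (nestingIndex g a) < k → semiRank g a < s at nestingIndex g a
  rank<s-at {a} a-semi x<k =
    subst (semiRank g a <_) (sym (label-at g _ (<-trans (n<1+n _) x<k))) (semiRank<semisFrom g a-semi ≤-refl)

  module Unranked {j i} (j<k∸1 : j < k ∸ 1) (i<d : i < (s at j) ∸ (s at suc j)) where
    j<k : suc j < k
    j<k = <∸1⇒suc< j<k∸1
    r<s-at-j : (s at suc j) + i < semisFrom g j
    r<s-at-j = subst ((s at suc j) + i <_) (label-at g j (<-trans (n<1+n j) j<k)) (<∸⇒+< i<d)
    found : Σ (Fin n) (λ a → isSemi (g a) ≡ true × semiRank g a ≡ (s at suc j) + i)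
    found = unrank n (isSemi ∘ g) (<-≤-trans r<s-at-j (semisFrom≤count g j))
    a : Fin n
    a = proj₁ found
    a-semi : g a ≡ semi
    a-semi = isSemi-true _ (proj₁ (proj₂ found))
    rank≡ : semiRank g a ≡ (s at suc j) + i
    rank≡ = proj₂ (proj₂ found)
    index≡ : nestingIndex g a ≡ j
    index≡ = nestingIndex-by-rank g a-semi
      (≤-trans (≤-reflexive (sym (label-at g (suc j) j<k))) (≤-trans (m≤m+n _ i) (≤-reflexive (sym rank≡))))
      (subst (_< semisFrom g j) (sym rank≡) r<s-at-j)

  -- A semi-arc of nesting index j and rank r is entry r - s_{j+1} of the range of rule (3)/(4) for j+1.
  module IndexRank (Q : ℕ → ℕ → Set) (Q-irrelevant : ∀ {j r} (q q′ : Q j r) → q ≡ q′) where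

    ShallowArc IndexRank : Set
    ShallowArc = Σ (Fin n) (λ a → Shallow a × Q (nestingIndex g a) (semiRank g a))
    IndexRank  = Σ ℕ (λ j → j < k ∸ 1 × Σ ℕ (λ i → i < (s at j) ∸ (s at suc j) × Q j ((s at suc j) + i)))

    toIndexRank : ShallowArc → IndexRank
    toIndexRank (a , (a-semi , x<k) , q) =
      x , suc<⇒<∸1 x<k , semiRank g a ∸ (s at suc x) ,
      ∸-monoˡ-< (rank<s-at a-semi x<k) (s-at-suc≤rank a-semi x<k) ,
      subst (Q x) (sym (m+[n∸m]≡n (s-at-suc≤rank a-semi x<k))) q
      where x = nestingIndex g a

    fromIndexRank : IndexRank → ShallowArc
    fromIndexRank (j , j<k∸1 , i , i<d , q) =
      a , (a-semi , subst (λ x → suc x < k) (sym index≡) j<k) , subst₂ Q (sym index≡) (sym rank≡) q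
      where open Unranked j<k∸1 i<d

    IndexRank-≡ : ∀ {j j′ i i′ p p′ d d′ q q′} → j ≡ j′ → i ≡ i′ →
      _≡_ {A = IndexRank} (j , p , i , d , q) (j′ , p′ , i′ , d′ , q′)
    IndexRank-≡ refl refl = cong₂ (λ p y → _ , p , _ , y) (≤-irrelevant _ _) (cong₂ _,_ (≤-irrelevant _ _) (Q-irrelevant _ _))

    ShallowArc-≡ : ∀ {a a′ p p′ q q′} → a ≡ a′ → _≡_ {A = ShallowArc} (a , p , q) (a′ , p′ , q′)
    ShallowArc-≡ refl = cong₂ (λ p q → _ , p , q) (cong₂ _,_ (uip _ _) (≤-irrelevant _ _)) (Q-irrelevant _ _)

    to∘from : ∀ y → toIndexRank (fromIndexRank y) ≡ y
    to∘from (j , j<k∸1 , i , i<d , q) = IndexRank-≡ index≡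
      (trans (cong₂ _∸_ rank≡ (cong (λ x → s at suc x) index≡)) (m+n∸m≡n (s at suc j) i))
      where open Unranked j<k∸1 i<d

    from∘to : ∀ x → fromIndexRank (toIndexRank x) ≡ x
    from∘to x@(a , (a-semi , x<k) , q) = ShallowArc-≡
      (rank-injective n (isSemi ∘ g) (cong isSemi a-semi′) (cong isSemi a-semi)
        (trans rank≡′ (m+[n∸m]≡n (s-at-suc≤rank a-semi x<k))))
      where
      open Unranked (suc<⇒<∸1 x<k) (proj₁ (proj₂ (proj₂ (proj₂ (toIndexRank x)))))
        renaming (a to a′; a-semi to a-semi′; rank≡ to rank≡′)

    shallow↔indexRank : ShallowArc ↔ IndexRank
    shallow↔indexRank = mk↔ₛ′ toIndexRank fromIndexRank to∘from from∘to

  deep-unique : ∀ {a b} → Deep a → Deep b → a ≡ b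
  deep-unique (a-semi , _ , rank≡0) (b-semi , _ , rank′≡0) =
    rank-injective n (isSemi ∘ g) (cong isSemi a-semi) (cong isSemi b-semi) (trans rank≡0 (sym rank′≡0))

  private
    k∸1<k : k ∸ 1 < k
    k∸1<k = subst (k ∸ 1 <_) (m+[n∸m]≡n k≥1) ≤-refl

    s-at-k∸1 : s at (k ∸ 1) ≡ semisFrom g (k ∸ 1)
    s-at-k∸1 = label-at g (k ∸ 1) k∸1<k

  deep⇒positive : ∀ {a} → Deep a → 0 < s at (k ∸ 1)
  deep⇒positive {a} (a-semi , k≤x , rank≡0) = subst₂ _<_ rank≡0 (sym s-at-k∸1)
    (semiRank<semisFrom g a-semi (∸-monoˡ-≤ 1 k≤x))

  positive⇒deep : 0 < s at (k ∸ 1) → Σ (Fin n) Deep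
  positive⇒deep positive = a , a-semi , k≤x , rank≡0
    where
    positive′ = subst (0 <_) s-at-k∸1 positive
    found = unrank n (isSemi ∘ g) (<-≤-trans positive′ (semisFrom≤count g (k ∸ 1)))
    a = proj₁ found
    a-semi = isSemi-true _ (proj₁ (proj₂ found))
    rank≡0 = proj₂ (proj₂ found)
    k≤x : k ≤ suc (nestingIndex g a)
    k≤x with k ∸ 1 ≤? nestingIndex g a
    ... | yes k∸1≤x = subst (_≤ suc (nestingIndex g a)) (m+[n∸m]≡n k≥1) (s≤s k∸1≤x)
    ... | no  k∸1≰x = ⊥-elim (<⇒≱ positive′
                        (subst (semisFrom g (k ∸ 1) ≤_) rank≡0 (semisFrom≤semiRank g a-semi (≰⇒> k∸1≰x))))

  ClosingTo : (Fin n → Set) → Bool → Vec ℕ k → Set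
  ClosingTo P o s′ = Σ (Fin n) (λ a → P a × label (extend g (step o (just a))) ≡ s′)

  rule34↔ : ∀ δ s′ → Any (s′ ≡_) (rule34 s δ)
    ↔ Σ ℕ (λ j → j < k ∸ 1 ×
              Σ ℕ (λ i → i < (s at j) ∸ (s at suc j) × s′ ≡ modLabel s δ (suc j) ((s at suc j) + i)))
  rule34↔ δ s′ = ↔-trans (Any-concatMap↔ _ (range 1 k)) (↔-trans (Any-range↔ 1 k)
    (Σ.congˡ (↔-refl ×-cong ↔-trans (↔-sym map↔) (Any-range↔ _ _))))

  shallow↔rule34 : ∀ o s′ → ClosingTo Shallow o s′ ↔ Any (s′ ≡_) (rule34 s (𝟙 (not o)))
  shallow↔rule34 o s′ = ↔-trans
    (Σ.congˡ λ {a} → Σ.congˡ λ {sh} → ≡-flip↔ (label-close-shallow g a (proj₁ sh) o (proj₂ sh)))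
    (↔-trans (IndexRank.shallow↔indexRank (λ j r → s′ ≡ modLabel s (𝟙 (not o)) (suc j) r) uip)
             (↔-sym (rule34↔ (𝟙 (not o)) s′)))

  deep↔lastLabel : ∀ o s′ → 0 < s at (k ∸ 1) → ClosingTo Deep o s′ ↔ (s′ ≡ lastLabel s (𝟙 (not o)))
  deep↔lastLabel o s′ positive = ↔-trans (↔-sym Σ-assoc) (↔-trans (Σ-contractible↔ a₀ contract)
    (≡-flip↔ (label-close-deep g (proj₁ a₀) (proj₁ (proj₂ a₀)) o (proj₁ (proj₂ (proj₂ a₀))))))
    where
    a₀ = positive⇒deep positive
    contract : ∀ x → a₀ ≡ x
    contract (a , d) with deep-unique (proj₂ a₀) d
    ... | refl = cong (a ,_) (cong₂ _,_ (uip _ _) (cong₂ _,_ (≤-irrelevant _ _) (uip _ _)))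

  deep↔rule5 : ∀ s′ → (ClosingTo Deep true s′ ⊎ ClosingTo Deep false s′) ↔ Any (s′ ≡_) (rule5 s)
  deep↔rule5 s′ = by-positivity (0 <ᵇ (s at (k ∸ 1))) refl
    where
    by-positivity : ∀ b → (0 <ᵇ (s at (k ∸ 1))) ≡ b →
      (ClosingTo Deep true s′ ⊎ ClosingTo Deep false s′)
      ↔ Any (s′ ≡_) (if b then lastLabel s 0 ∷ lastLabel s 1 ∷ [] else [])
    by-positivity true  eq = ↔-trans (deep↔lastLabel true s′ positive ⊎-cong deep↔lastLabel false s′ positive)
      (↔-trans (↔-refl ⊎-cong ↔-trans (↔-sym ⊎-⊥↔) (↔-refl ⊎-cong ⊥↔Any[]))
               (↔-trans (↔-refl ⊎-cong ∷↔ _) (∷↔ _)))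
      where positive = <ᵇ⇒< 0 _ (Equivalence.from T-≡ eq)
    by-positivity false eq = ↔-trans (¬⇒↔⊥ no-deep ⊎-cong ¬⇒↔⊥ no-deep)
      (↔-trans ⊎-⊥↔ ⊥↔Any[])
      where
      not-positive : ¬ (0 < s at (k ∸ 1))
      not-positive positive = case trans (sym (Equivalence.to T-≡ (<⇒<ᵇ positive))) eq of λ ()
      no-deep : ∀ {o} → ¬ ClosingTo Deep o s′
      no-deep (_ , deep , _) = not-positive (deep⇒positive deep)

  children-Any↔ : ∀ s′ → Any (s′ ≡_) (children s) ↔
    ((s′ ≡ s) ⊎ (s′ ≡ inc0 s) ⊎
     Any (s′ ≡_) (rule34 s 0) ⊎ Any (s′ ≡_) (rule34 s 1) ⊎ Any (s′ ≡_) (rule5 s))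
  children-Any↔ s′ = ↔-sym (↔-trans (↔-refl ⊎-cong ↔-refl ⊎-cong ↔-refl ⊎-cong ++↔)
    (↔-trans (↔-refl ⊎-cong ↔-refl ⊎-cong ++↔) (↔-trans (↔-refl ⊎-cong ∷↔ _) (∷↔ _))))

  module _ (no-nesting : NoNesting g) (no-future : NoFutureNesting g) where

    opening↔ : ∀ o {E : Set} → (Admissible D (step o nothing) × E) ↔ E
    opening↔ o = mk↔ₛ′ proj₂ (admissible-nothing no-nesting no-future o ,_) (λ _ → refl) (λ _ → refl)

    closing↔ : ∀ o s′ →
      Σ (Fin n) (λ a → Admissible D (step o (just a)) × label (extend g (step o (just a))) ≡ s′)
                       ↔ (ClosingTo Shallow o s′ ⊎ ClosingTo Deep o s′)
    closing↔ o s′ =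
      ↔-trans (Σ.congˡ (↔-trans (admissible↔ no-nesting no-future o _ ×-cong ↔-refl) ×-distribʳ-⊎)) Σ-distribˡ-⊎

    children↔ : ∀ s′ →
      Σ (Step n) (λ st → Admissible D st × label (extend g st) ≡ s′) ↔ Any (s′ ≡_) (children s)
    children↔ s′ =
      Σ (Step n) (λ st → Admissible D st × label (extend g st) ≡ s′)
        ↔⟨ Σ-Step↔ ⟩
      _ ↔⟨ opening↔ false ⊎-cong opening↔ true ⊎-cong closing↔ true s′ ⊎-cong closing↔ false s′ ⟩
      _ ↔⟨ ↔-refl ⊎-cong ↔-refl ⊎-cong ⊎-interchange ⟩
      _ ↔⟨ ≡-flip↔ (label-open-none g) ⊎-cong ≡-flip↔ (label-open-semi g) ⊎-cong
           shallow↔rule34 true s′ ⊎-cong shallow↔rule34 false s′ ⊎-cong deep↔rule5 s′ ⟩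
      _ ↔⟨ children-Any↔ s′ ⟨
      Any (s′ ≡_) (children s) ∎
      where open EquationalReasoning

module Counting (k : ℕ) (k≥1 : 1 ≤ k) where
  open Nonnesting k
  open Growth k
  open Labels k

  labelOf : ∀ {n} → NonnestingDiagram k n → Vec ℕ k
  labelOf d = label (outs (diagram d))

  Fibre : ℕ → Vec ℕ k → Set
  Fibre n s′ = Σ (NonnestingDiagram k n) (λ d → labelOf d ≡ s′)

  noNesting : ∀ {n} (d : NonnestingDiagram k n) → NoNesting (outs (diagram d))
  noNesting (mkΠ D ¬N _) = recompute (_ ≤? k) (¬Nesting⇒NoNesting D ¬N)

  noFutureNesting : ∀ {n} (d : NonnestingDiagram k n) → NoFutureNesting (outs (diagram d))
  noFutureNesting (mkΠ D _ ¬F) a a-semi = recompute (_ <? k) (¬FutureNesting⇒NoFutureNesting D ¬F a a-semi)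

  empty-diagram : NonnestingDiagram k 0
  empty-diagram = mkΠ (mkOPD Vec.[] (λ ()) (λ ())) (λ N → case lefts N F.zero of λ ()) (λ ())

  fibre₀↔ : ∀ s′ → Fibre 0 s′ ↔ s′ ∈ level k 0
  fibre₀↔ s′ = ↔-trans (Σ-contractible↔ empty-diagram (λ _ → NonnestingDiagram-≡ (diagram-≡ λ ())))
    (↔-trans (≡-flip↔ label₀) (↔-trans (↔-sym ⊎-⊥↔) (↔-trans (↔-refl ⊎-cong ⊥↔Any[]) (∷↔ _))))
    where
    label₀ : labelOf empty-diagram ≡ Vec.replicate k 0
    label₀ = trans (VP.tabulate-cong λ i → sym (VP.lookup-replicate i 0)) (VP.tabulate∘lookup _)

  fibre↔ : ∀ n s′ → Fibre n s′ ↔ s′ ∈ level k n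
  fibre↔ zero    s′ = fibre₀↔ s′
  fibre↔ (suc n) s′ =
    Fibre (suc n) s′
      ↔⟨ Σ.cong growth (λ {D} →
           K-reflexive (cong (λ D → labelOf D ≡ s′) (sym (Inverse.strictlyInverseʳ growth D)))) ⟩
    Σ (Σ (NonnestingDiagram k n) Extension) (λ x → labelOf (extendNN x) ≡ s′)
      ↔⟨ Σ-assoc ⟩
    Σ (NonnestingDiagram k n) (λ d → Σ (Extension d) (λ e → labelOf (extendNN (d , e)) ≡ s′))
      ↔⟨ Σ.congˡ (λ {d} → regroup d) ⟩
    Σ (NonnestingDiagram k n)
      (λ d → Σ (Step n) (λ st → Admissible (diagram d) st × label (extend (outs (diagram d)) st) ≡ s′))
      ↔⟨ Σ.congˡ (λ {d} → Children.children↔ k k≥1 (diagram d) (noNesting d) (noFutureNesting d) s′) ⟩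
    Σ (NonnestingDiagram k n) (λ d → s′ ∈ children (labelOf d))
      ↔⟨ Σ-fibres↔ labelOf ⟩
    Σ (Vec ℕ k) (λ s → Fibre n s × s′ ∈ children s)
      ↔⟨ Σ.congˡ (λ {s} → fibre↔ n s ×-cong ↔-refl) ⟩
    Σ (Vec ℕ k) (λ s → s ∈ level k n × s′ ∈ children s)
      ↔⟨ Any↔ ⟩
    Any (λ s → s′ ∈ children s) (level k n)
      ↔⟨ Any-concatMap↔ children (level k n) ⟨
    s′ ∈ level k (suc n) ∎
    where
    open EquationalReasoning
    regroup : ∀ d → Σ (Extension d) (λ e → labelOf (extendNN (d , e)) ≡ s′)
                    ↔ Σ (Step n) (λ st → Admissible (diagram d) st × label (extend (outs (diagram d)) st) ≡ s′)
    regroup d = ↔-trans Σ-assoc (Σ.congˡ λ {st} →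
      ↔-refl ×-cong K-reflexive (cong (_≡ s′) (label-cong (outs-extendD (diagram d) st))))

theorem5 : (k : ℕ) → 1 ≤ k → (n : ℕ) →
    NonnestingDiagram k n ↔ Fin (length (level k n))
theorem5 k k≥1 n =
  NonnestingDiagram k n                       ↔⟨ partition↔ labelOf ⟩
  Σ (Vec ℕ k) (Fibre n)                       ↔⟨ Σ.congˡ (λ {s} → fibre↔ n s) ⟩
  Σ (Vec ℕ k) (λ s → s ∈ level k n)           ↔⟨ ∈-Fin-length↔ (level k n) ⟩
  Fin (length (level k n))                    ∎
  where
  open Counting k k≥1
  open EquationalReasoning
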